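{- Let $SNT$ and $WELL$ be the index sets defined below. Then $SNT\equiv_m WELL$.
   Context: $\varphi_e$ denotes the $e$-th partial computable function; $\equiv_m$ is many-one equivalence ($A\leq_m B$ iff there is a total computable $f$ with $x\in A\iff f(x)\in B$). A Wang prototile is a 4-tuple $\langle l,u,r,b\rangle$ of colours (natural numbers) for the left, upper, right and bottom quarters of a diagonally quadrisected unit square; prototile sets are identified with sets of codes of 4-tuples. For a set $S$ of Wang prototiles and a region $R\subseteq\mathbb{Z}^2$, an $S$-tiling of $R$ is a map $f:R\to S$ such that whenever $(x,y),(x+1,y)\in R$ the right colour of $f(x,y)$ equals the left colour of $f(x+1,y)$, and whenever $(x,y),(x,y+1)\in R$ the upper colour of $f(x,y)$ equals the bottom colour of $f(x,y+1)$ (no rotations). Such a tiling is connected if $R$ is connected in the grid graph of $\mathbb{Z}^2$ (horizontal/vertical neighbours). $SNT=\{e:\varphi_e$ is the characteristic function of a set $S$ of Wang prototiles all of whose connected $S$-tilings are finite$\}$. A tree is a subset of $\omega^{<\omega}$ closed under initial segments; $WELL=\{e:\varphi_e$ is the characteristic function of a tree $T\subseteq\omega^{<\omega}$ with no infinite path$\}$. -}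

module Defs where

open import Level using (Level; _⊔_) renaming (suc to lsuc; zero to lzero)
open import Data.Nat using (ℕ; zero; suc; _+_; _<_)
open import Data.Integer using (ℤ) renaming (_+_ to _+ℤ_; 1ℤ to one)
open import Data.Product using (Σ; ∃; _×_; _,_; proj₁; proj₂)
open import Data.Sum using (_⊎_)
open import Data.List using (List; []; _∷_; _++_; applyUpTo)
open import Data.List.Membership.Propositional using (_∈_)
open import Relation.Binary.PropositionalEquality using (_≡_)
open import Relation.Nullary using (¬_)
open import Function.Bundles using (_⇔_)

-- Cantor pairing (a computable bijection ℕ × ℕ ≅ ℕ)
-- unpair enumerates ℕ × ℕ diagonal by diagonal:
-- (0,0),(1,0),(0,1),(2,0),(1,1),(0,2),...

next : ℕ × ℕ → ℕ × ℕ
next (zero  , y) = (suc y , zero)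
next (suc x , y) = (x , suc y)

unpair : ℕ → ℕ × ℕ
unpair zero    = (0 , 0)
unpair (suc n) = next (unpair n)

tri : ℕ → ℕ
tri zero    = zero
tri (suc k) = suc k + tri k

-- inverse of unpair
pair : ℕ → ℕ → ℕ
pair x y = tri (x + y) + y

-- A standard model of computation: unary partial recursive functions
-- on ℕ (with pairing), given by program syntax and a big-step
-- evaluation relation.

data Prog : Set where
  Zc Sc Ic Lc Rc : Prog
  compc  : Prog → Prog → Prog   -- compc f g x = f (g x)
  pairc  : Prog → Prog → Prog   -- pairc f g x = pair (f x) (g x)
  recc   : Prog → Prog → Prog   -- primitive recursion, input pair a n
  muc    : Prog → Prog          -- minimisation: μ n. f (pair x n) = 0

mutual
  data _⟨_⟩⇓_ : Prog → ℕ → ℕ → Set where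
    zE    : ∀ {x} → Zc ⟨ x ⟩⇓ 0
    sE    : ∀ {x} → Sc ⟨ x ⟩⇓ suc x
    iE    : ∀ {x} → Ic ⟨ x ⟩⇓ x
    lE    : ∀ {x} → Lc ⟨ x ⟩⇓ proj₁ (unpair x)
    rE    : ∀ {x} → Rc ⟨ x ⟩⇓ proj₂ (unpair x)
    compE : ∀ {f g x y z} → g ⟨ x ⟩⇓ y → f ⟨ y ⟩⇓ z → compc f g ⟨ x ⟩⇓ z
    pairE : ∀ {f g x a b} → f ⟨ x ⟩⇓ a → g ⟨ x ⟩⇓ b → pairc f g ⟨ x ⟩⇓ pair a b
    recE  : ∀ {f g x z} → Rec f g (proj₁ (unpair x)) (proj₂ (unpair x)) z →
            recc f g ⟨ x ⟩⇓ z
    muE   : ∀ {f x n} → f ⟨ pair x n ⟩⇓ 0 →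
            (∀ m → m < n → ∃ λ k → f ⟨ pair x m ⟩⇓ suc k) →
            muc f ⟨ x ⟩⇓ n

  data Rec (f g : Prog) (a : ℕ) : ℕ → ℕ → Set where
    rec0 : ∀ {z} → f ⟨ a ⟩⇓ z → Rec f g a 0 z
    recS : ∀ {n w z} → Rec f g a n w → g ⟨ pair a (pair n w) ⟩⇓ z →
           Rec f g a (suc n) z

-- Effective (surjective) numbering of programs; fuel n suffices for code n.
decodeTag : (ℕ → Prog) → ℕ → ℕ → Prog
decodeTag d 0 r = Zc
decodeTag d 1 r = Sc
decodeTag d 2 r = Ic
decodeTag d 3 r = Lc
decodeTag d 4 r = Rc
decodeTag d 5 r = compc (d (proj₁ (unpair r))) (d (proj₂ (unpair r)))
decodeTag d 6 r = pairc (d (proj₁ (unpair r))) (d (proj₂ (unpair r)))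
decodeTag d 7 r = recc  (d (proj₁ (unpair r))) (d (proj₂ (unpair r)))
decodeTag d (suc (suc (suc (suc (suc (suc (suc (suc _)))))))) r = muc (d r)

decodeF : ℕ → ℕ → Prog
decodeF zero    n = Zc
decodeF (suc k) n = decodeTag (decodeF k) (proj₁ (unpair n)) (proj₂ (unpair n))

decode : ℕ → Prog
decode n = decodeF n n

φ_⟨_⟩≃_ : ℕ → ℕ → ℕ → Set
φ e ⟨ x ⟩≃ y = decode e ⟨ x ⟩⇓ y

Computable : (ℕ → ℕ) → Set
Computable f = ∃ λ e → ∀ x → φ e ⟨ x ⟩≃ f x

_≤m_ : ∀ {a b} → (ℕ → Set a) → (ℕ → Set b) → Set (a ⊔ b)
A ≤m B = ∃ λ (f : ℕ → ℕ) → Computable f × (∀ x → A x ⇔ B (f x))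

_≡m_ : ∀ {a b} → (ℕ → Set a) → (ℕ → Set b) → Set (a ⊔ b)
A ≡m B = (A ≤m B) × (B ≤m A)

IsCharFn : ∀ {ℓ} {X : Set} → (X → ℕ) → ℕ → (X → Set ℓ) → Set ℓ
IsCharFn c e S = ∀ x → (S x → φ e ⟨ c x ⟩≃ 1) × (¬ S x → φ e ⟨ c x ⟩≃ 0)

-- Wang tiles: a natural number n codes the 4-tuple ⟨l,u,r,b⟩ with
-- n = pair l (pair u (pair r b)).

left up right bottom : ℕ → ℕ
left   n = proj₁ (unpair n)
up     n = proj₁ (unpair (proj₂ (unpair n)))
right  n = proj₁ (unpair (proj₂ (unpair (proj₂ (unpair n)))))
bottom n = proj₂ (unpair (proj₂ (unpair (proj₂ (unpair n)))))

Point : Set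
Point = ℤ × ℤ

Region : Set₁
Region = Point → Set

-- f : ℤ² → ℕ is an S-tiling of R (only its values on R matter)
IsTiling : (ℕ → Set) → Region → (Point → ℕ) → Set
IsTiling S R f =
  (∀ p → R p → S (f p)) ×
  (∀ x y → R (x , y) → R (x +ℤ one , y) → right (f (x , y)) ≡ left (f (x +ℤ one , y))) ×
  (∀ x y → R (x , y) → R (x , y +ℤ one) → up (f (x , y)) ≡ bottom (f (x , y +ℤ one)))

Adj : Point → Point → Set
Adj (x , y) (x' , y') =
  (x' ≡ x +ℤ one × y' ≡ y) ⊎ (x ≡ x' +ℤ one × y ≡ y') ⊎
  (x' ≡ x × y' ≡ y +ℤ one) ⊎ (x ≡ x' × y ≡ y' +ℤ one)

data PathIn (R : Region) : Point → Point → Set where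
  here : ∀ {p} → R p → PathIn R p p
  step : ∀ {p p' q} → R p → Adj p p' → PathIn R p' q → PathIn R p q

Connected : Region → Set
Connected R = ∀ p q → R p → R q → PathIn R p q

Finite : Region → Set
Finite R = ∃ λ (L : List Point) → ∀ p → R p → p ∈ L

SNT : ℕ → Set₁
SNT e = Σ (ℕ → Set) λ S → IsCharFn (λ n → n) e S ×
          (∀ (R : Region) (f : Point → ℕ) → Connected R → IsTiling S R f → Finite R)

-- Trees on ω^{<ω}; sequences coded bijectively by encodeSeq

encodeSeq : List ℕ → ℕ
encodeSeq []      = 0
encodeSeq (h ∷ t) = suc (pair h (encodeSeq t))

IsTree : (List ℕ → Set) → Set
IsTree T = ∀ σ τ → T (σ ++ τ) → T σ

HasInfinitePath : (List ℕ → Set) → Set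
HasInfinitePath T = ∃ λ (p : ℕ → ℕ) → ∀ k → T (applyUpTo p k)

WELL : ℕ → Set₁
WELL e = Σ (List ℕ → Set) λ T → IsCharFn encodeSeq e T × IsTree T × ¬ HasInfinitePath T

-- Both reductions are uniform in an oracle for the given set: a term, primitive recursive in the
-- oracle, computes the new set from the old one, and substituting the program φ e for the oracle
-- gives the reduction e ↦ red e. The oracle is also queried on the input itself, which makes
-- φ (red e) a characteristic function only if φ e is one.
--
-- SNT ≤m WELL: a node of the tree is a finite sequence of placements (point, tile) in which every
-- placement is at a new point, next to an earlier one, and matches its earlier neighbours. A branch
-- is an infinite connected tiling; conversely an infinite connected tiling can be enumerated
-- (classically) so that all its initial segments are nodes.
--
-- WELL ≤m SNT: the tiles are ⟨code (init τ), 0, code τ, 1⟩ for τ ≠ [] with all prefixes in the tree,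
-- and junk tiles ⟨c, c, c, c⟩ for codes c in the tree having a prefix outside it. A junk tile tiles
-- a whole row, so none exists exactly when the set is a tree. The other tiles never stack vertically,
-- and along a row their right colours code sequences growing by one entry per step. So an infinite
-- connected tiling contains a ray spelling out an infinite branch, and a branch gives such a row.

module Submission where

open import Defs
open import Axiom.ExcludedMiddle using (ExcludedMiddle)
open import Level using (Level) renaming (suc to lsuc; zero to lzero; _⊔_ to _⊔ℓ_)
open import Data.Empty using (⊥; ⊥-elim)
open import Data.Unit using (tt)
open import Data.Nat
open import Data.Nat.Properties
open import Data.Integer using (ℤ; +_; -[1+_]; _⊖_; _-_; -_; +≤+)
  renaming (_+_ to _+ℤ_; 1ℤ to one; _≤_ to _≤ℤ_; _<_ to _<ℤ_)
import Data.Integer.Properties as ℤP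
open import Data.Integer.Solver using (module +-*-Solver)
open import Data.Bool using (Bool; true; false; _∧_; _∨_; not; T)
open import Data.Bool.Properties using (T-∧; T-∨; ∧-assoc; ∧-identityʳ; ∨-assoc; ∨-identityʳ)
open import Data.Bool.ListAction using (any; all)
open import Data.Product using (Σ; ∃; _×_; _,_; proj₁; proj₂)
open import Data.Product.Properties using (×-≡,≡→≡; ×-≡,≡←≡)
open import Data.Sum as Sum using (_⊎_; inj₁; inj₂)
open import Data.List using (List; []; _∷_; _++_; [_]; foldl; length; reverse; applyUpTo; lookup; null; drop)
open import Data.List.Properties
  using (∷-injective; reverse-++; ++-assoc; unfold-reverse; reverse-involutive; ++-identityʳ;
         applyUpTo-∷ʳ; length-++; length-applyUpTo)
open import Data.List.Relation.Unary.Any as Any using (Any; here; there; index)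
import Data.List.Relation.Unary.Any.Properties as AnyP
open import Data.List.Relation.Unary.Any.Properties using (any⁺; any⁻)
import Data.List.Relation.Unary.All as All
open import Data.List.Relation.Unary.All.Properties using (all⁺; all⁻)
open import Data.List.Membership.Propositional using (_∈_; find; lose)
open import Data.Fin using (Fin; toℕ)
import Data.Fin.Properties as FinP
open import Relation.Binary.PropositionalEquality hiding ([_])
open import Relation.Binary.Definitions using (tri<; tri≈; tri>)
open import Relation.Nullary using (¬_; yes; no)
open import Function.Bundles using (_⇔_; mk⇔; Equivalence)
open Equivalence

-- Cantor pairing

unpair-tri : ∀ s y → y ≤ s → unpair (tri s + y) ≡ (s ∸ y , y)
unpair-tri zero .zero z≤n = refl
unpair-tri (suc s) zero _ rewrite +-identityʳ (s + tri s) | +-comm s (tri s) | unpair-tri s s ≤-refl | n∸n≡0 s = refl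
unpair-tri (suc s) (suc y) (s≤s y≤s) = begin
    unpair (tri (suc s) + suc y)     ≡⟨ cong unpair (+-suc (tri (suc s)) y) ⟩
    next (unpair (tri (suc s) + y))  ≡⟨ cong next (unpair-tri (suc s) y (m≤n⇒m≤1+n y≤s)) ⟩
    next (suc s ∸ y , y)             ≡⟨ cong (λ z → next (z , y)) (+-∸-assoc 1 y≤s) ⟩
    (s ∸ y , suc y)                  ∎
  where open ≡-Reasoning

unpair-pair : ∀ x y → unpair (pair x y) ≡ (x , y)
unpair-pair x y rewrite unpair-tri (x + y) y (m≤n+m y x) | m+n∸n≡m x y = refl

fst-pair : ∀ x y → proj₁ (unpair (pair x y)) ≡ x
fst-pair x y = cong proj₁ (unpair-pair x y)

snd-pair : ∀ x y → proj₂ (unpair (pair x y)) ≡ y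
snd-pair x y = cong proj₂ (unpair-pair x y)

pair-injective : ∀ {a b c d} → pair a b ≡ pair c d → a ≡ c × b ≡ d
pair-injective {a} {b} {c} {d} e =
  trans (sym (fst-pair a b)) (trans (cong (λ z → proj₁ (unpair z)) e) (fst-pair c d)) ,
  trans (sym (snd-pair a b)) (trans (cong (λ z → proj₂ (unpair z)) e) (snd-pair c d))

pair-next : ∀ p → pair (proj₁ (next p)) (proj₂ (next p)) ≡ suc (pair (proj₁ p) (proj₂ p))
pair-next (zero , b) rewrite +-identityʳ b | +-identityʳ (suc b + tri b) | +-comm b (tri b) = refl
pair-next (suc a , b) rewrite +-suc a b | +-suc (tri (suc (a + b))) b = refl

pair-unpair : ∀ n → pair (proj₁ (unpair n)) (proj₂ (unpair n)) ≡ n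
pair-unpair zero = refl
pair-unpair (suc n) rewrite pair-next (unpair n) | pair-unpair n = refl

n≤tri[n] : ∀ n → n ≤ tri n
n≤tri[n] zero = z≤n
n≤tri[n] (suc n) = m≤m+n (suc n) (tri n)

x≤pair[x,y] : ∀ x y → x ≤ pair x y
x≤pair[x,y] x y = ≤-trans (≤-trans (m≤m+n x y) (n≤tri[n] (x + y))) (m≤m+n (tri (x + y)) y)

y≤pair[x,y] : ∀ x y → y ≤ pair x y
y≤pair[x,y] x y = m≤n+m y (tri (x + y))

y<pair[x,y] : ∀ x y → 1 ≤ x → y < pair x y
y<pair[x,y] x y 1≤x = ≤-trans (+-monoˡ-≤ y 1≤x) (+-monoˡ-≤ y (≤-trans (m≤m+n x y) (n≤tri[n] (x + y))))

unpair₁≤ : ∀ n → proj₁ (unpair n) ≤ n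
unpair₁≤ n = subst (proj₁ (unpair n) ≤_) (pair-unpair n) (x≤pair[x,y] (proj₁ (unpair n)) (proj₂ (unpair n)))

unpair₂≤ : ∀ n → proj₂ (unpair n) ≤ n
unpair₂≤ n = subst (proj₂ (unpair n) ≤_) (pair-unpair n) (y≤pair[x,y] (proj₁ (unpair n)) (proj₂ (unpair n)))

-- Programs: determinism and decoding

mutual
  ⇓-deterministic : ∀ {f x a b} → f ⟨ x ⟩⇓ a → f ⟨ x ⟩⇓ b → a ≡ b
  ⇓-deterministic zE zE = refl
  ⇓-deterministic sE sE = refl
  ⇓-deterministic iE iE = refl
  ⇓-deterministic lE lE = refl
  ⇓-deterministic rE rE = refl
  ⇓-deterministic (compE p q) (compE p' q') with ⇓-deterministic p p'
  ... | refl = ⇓-deterministic q q'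
  ⇓-deterministic (pairE p q) (pairE p' q') = cong₂ pair (⇓-deterministic p p') (⇓-deterministic q q')
  ⇓-deterministic (recE r) (recE r') = Rec-deterministic r r'
  ⇓-deterministic (muE {n = n} z h) (muE {n = n'} z' h') with <-cmp n n'
  ... | tri≈ _ e _ = e
  ... | tri< n<n' _ _ = ⊥-elim (0≢1+n (⇓-deterministic z (proj₂ (h' n n<n'))))
  ... | tri> _ _ n'<n = ⊥-elim (0≢1+n (⇓-deterministic z' (proj₂ (h n' n'<n))))

  Rec-deterministic : ∀ {f g a n z z'} → Rec f g a n z → Rec f g a n z' → z ≡ z'
  Rec-deterministic (rec0 p) (rec0 p') = ⇓-deterministic p p'
  Rec-deterministic (recS r p) (recS r' p') with Rec-deterministic r r'
  ... | refl = ⇓-deterministic p p'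

decodeF-0 : ∀ k → decodeF k 0 ≡ Zc
decodeF-0 zero = refl
decodeF-0 (suc k) = refl

decodeTag-cong : ∀ d d' t r → (1 ≤ t → ∀ c → c ≤ r → d c ≡ d' c) → decodeTag d t r ≡ decodeTag d' t r
decodeTag-cong d d' 0 r h = refl
decodeTag-cong d d' 1 r h = refl
decodeTag-cong d d' 2 r h = refl
decodeTag-cong d d' 3 r h = refl
decodeTag-cong d d' 4 r h = refl
decodeTag-cong d d' 5 r h = cong₂ compc (h (s≤s z≤n) _ (unpair₁≤ r)) (h (s≤s z≤n) _ (unpair₂≤ r))
decodeTag-cong d d' 6 r h = cong₂ pairc (h (s≤s z≤n) _ (unpair₁≤ r)) (h (s≤s z≤n) _ (unpair₂≤ r))
decodeTag-cong d d' 7 r h = cong₂ recc (h (s≤s z≤n) _ (unpair₁≤ r)) (h (s≤s z≤n) _ (unpair₂≤ r))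
decodeTag-cong d d' (suc (suc (suc (suc (suc (suc (suc (suc _)))))))) r h = cong muc (h (s≤s z≤n) r ≤-refl)

-- The sub-codes of a code c > 0 are < c, so any fuel ≥ c gives the same program.
decodeF-stable : ∀ k k' c → c ≤ k → c ≤ k' → decodeF k c ≡ decodeF k' c
decodeF-stable k k' zero _ _ = trans (decodeF-0 k) (sym (decodeF-0 k'))
decodeF-stable (suc j) (suc j') (suc c) (s≤s c≤j) (s≤s c≤j') =
  decodeTag-cong (decodeF j) (decodeF j') t r λ 1≤t d d≤r →
    let d≤c : d ≤ c
        d≤c = ≤-trans d≤r (≤-pred (subst (r <_) (pair-unpair (suc c)) (y<pair[x,y] t r 1≤t)))
    in decodeF-stable j j' d (≤-trans d≤c c≤j) (≤-trans d≤c c≤j')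
  where
  t r : ℕ
  t = proj₁ (unpair (suc c))
  r = proj₂ (unpair (suc c))

decode-pair : ∀ t r → 1 ≤ t → decode (pair t r) ≡ decodeTag decode t r
decode-pair t r 1≤t = go (pair t r) refl
  where
  go : ∀ c → c ≡ pair t r → decode c ≡ decodeTag decode t r
  go zero eq = ⊥-elim (<⇒≱ (≤-trans 1≤t (x≤pair[x,y] t r)) (≤-reflexive (sym eq)))
  go (suc c) eq = begin
      decodeTag (decodeF c) (proj₁ (unpair (suc c))) (proj₂ (unpair (suc c)))
        ≡⟨ cong (λ n → decodeTag (decodeF c) (proj₁ (unpair n)) (proj₂ (unpair n))) eq ⟩
      decodeTag (decodeF c) (proj₁ (unpair (pair t r))) (proj₂ (unpair (pair t r)))
        ≡⟨ cong₂ (decodeTag (decodeF c)) (fst-pair t r) (snd-pair t r) ⟩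
      decodeTag (decodeF c) t r
        ≡⟨ decodeTag-cong (decodeF c) decode t r (λ _ d d≤r →
             decodeF-stable c d d (≤-trans d≤r (≤-pred (subst (r <_) (sym eq) (y<pair[x,y] t r 1≤t)))) ≤-refl) ⟩
      decodeTag decode t r ∎
    where open ≡-Reasoning


-- Program templates

data Template : Set where
  hole zT sT iT lT rT : Template
  compT pairT recT : Template → Template → Template
  muT : Template → Template

fill : Template → Prog → Prog
fill hole q = q
fill zT q = Zc
fill sT q = Sc
fill iT q = Ic
fill lT q = Lc
fill rT q = Rc
fill (compT a b) q = compc (fill a q) (fill b q)
fill (pairT a b) q = pairc (fill a q) (fill b q)
fill (recT a b) q = recc (fill a q) (fill b q)
fill (muT a) q = muc (fill a q)

fillCode : Template → ℕ → ℕ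
fillCode hole e = e
fillCode zT e = pair 0 0
fillCode sT e = pair 1 0
fillCode iT e = pair 2 0
fillCode lT e = pair 3 0
fillCode rT e = pair 4 0
fillCode (compT a b) e = pair 5 (pair (fillCode a e) (fillCode b e))
fillCode (pairT a b) e = pair 6 (pair (fillCode a e) (fillCode b e))
fillCode (recT a b) e = pair 7 (pair (fillCode a e) (fillCode b e))
fillCode (muT a) e = pair 8 (fillCode a e)

decode-binary : ∀ t (op : Prog → Prog → Prog) x y → 1 ≤ t →
  decodeTag decode t (pair x y) ≡ op (decode (proj₁ (unpair (pair x y)))) (decode (proj₂ (unpair (pair x y)))) →
  decode (pair t (pair x y)) ≡ op (decode x) (decode y)
decode-binary t op x y 1≤t tag = begin
  decode (pair t (pair x y))   ≡⟨ decode-pair t (pair x y) 1≤t ⟩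
  decodeTag decode t (pair x y) ≡⟨ tag ⟩
  op (decode (proj₁ (unpair (pair x y)))) (decode (proj₂ (unpair (pair x y))))
    ≡⟨ cong₂ (λ a b → op (decode a) (decode b)) (fst-pair x y) (snd-pair x y) ⟩
  op (decode x) (decode y)     ∎
  where open ≡-Reasoning

decode-fillCode : ∀ t e → decode (fillCode t e) ≡ fill t (decode e)
decode-fillCode hole e = refl
decode-fillCode zT e = refl
decode-fillCode sT e = decode-pair 1 0 (s≤s z≤n)
decode-fillCode iT e = decode-pair 2 0 (s≤s z≤n)
decode-fillCode lT e = decode-pair 3 0 (s≤s z≤n)
decode-fillCode rT e = decode-pair 4 0 (s≤s z≤n)
decode-fillCode (compT a b) e =
  trans (decode-binary 5 compc (fillCode a e) (fillCode b e) (s≤s z≤n) refl) (cong₂ compc (decode-fillCode a e) (decode-fillCode b e))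
decode-fillCode (pairT a b) e =
  trans (decode-binary 6 pairc (fillCode a e) (fillCode b e) (s≤s z≤n) refl) (cong₂ pairc (decode-fillCode a e) (decode-fillCode b e))
decode-fillCode (recT a b) e =
  trans (decode-binary 7 recc (fillCode a e) (fillCode b e) (s≤s z≤n) refl) (cong₂ recc (decode-fillCode a e) (decode-fillCode b e))
decode-fillCode (muT a) e = trans (decode-pair 8 (fillCode a e) (s≤s z≤n)) (cong muc (decode-fillCode a e))

constP : ℕ → Prog
constP zero = Zc
constP (suc n) = compc Sc (constP n)

constP-⇓ : ∀ n {x} → constP n ⟨ x ⟩⇓ n
constP-⇓ zero = zE
constP-⇓ (suc n) = compE (constP-⇓ n) sE

fillCodeP : Template → Prog
fillCodeP hole = Ic
fillCodeP zT = pairc (constP 0) (constP 0)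
fillCodeP sT = pairc (constP 1) (constP 0)
fillCodeP iT = pairc (constP 2) (constP 0)
fillCodeP lT = pairc (constP 3) (constP 0)
fillCodeP rT = pairc (constP 4) (constP 0)
fillCodeP (compT a b) = pairc (constP 5) (pairc (fillCodeP a) (fillCodeP b))
fillCodeP (pairT a b) = pairc (constP 6) (pairc (fillCodeP a) (fillCodeP b))
fillCodeP (recT a b) = pairc (constP 7) (pairc (fillCodeP a) (fillCodeP b))
fillCodeP (muT a) = pairc (constP 8) (fillCodeP a)

fillCodeP-⇓ : ∀ t e → fillCodeP t ⟨ e ⟩⇓ fillCode t e
fillCodeP-⇓ hole e = iE
fillCodeP-⇓ zT e = pairE (constP-⇓ 0) (constP-⇓ 0)
fillCodeP-⇓ sT e = pairE (constP-⇓ 1) (constP-⇓ 0)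
fillCodeP-⇓ iT e = pairE (constP-⇓ 2) (constP-⇓ 0)
fillCodeP-⇓ lT e = pairE (constP-⇓ 3) (constP-⇓ 0)
fillCodeP-⇓ rT e = pairE (constP-⇓ 4) (constP-⇓ 0)
fillCodeP-⇓ (compT a b) e = pairE (constP-⇓ 5) (pairE (fillCodeP-⇓ a e) (fillCodeP-⇓ b e))
fillCodeP-⇓ (pairT a b) e = pairE (constP-⇓ 6) (pairE (fillCodeP-⇓ a e) (fillCodeP-⇓ b e))
fillCodeP-⇓ (recT a b) e = pairE (constP-⇓ 7) (pairE (fillCodeP-⇓ a e) (fillCodeP-⇓ b e))
fillCodeP-⇓ (muT a) e = pairE (constP-⇓ 8) (fillCodeP-⇓ a e)

holeless : Prog → Template
holeless Zc = zT
holeless Sc = sT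
holeless Ic = iT
holeless Lc = lT
holeless Rc = rT
holeless (compc a b) = compT (holeless a) (holeless b)
holeless (pairc a b) = pairT (holeless a) (holeless b)
holeless (recc a b) = recT (holeless a) (holeless b)
holeless (muc a) = muT (holeless a)

fill-holeless : ∀ p q → fill (holeless p) q ≡ p
fill-holeless Zc q = refl
fill-holeless Sc q = refl
fill-holeless Ic q = refl
fill-holeless Lc q = refl
fill-holeless Rc q = refl
fill-holeless (compc a b) q = cong₂ compc (fill-holeless a q) (fill-holeless b q)
fill-holeless (pairc a b) q = cong₂ pairc (fill-holeless a q) (fill-holeless b q)
fill-holeless (recc a b) q = cong₂ recc (fill-holeless a q) (fill-holeless b q)
fill-holeless (muc a) q = cong muc (fill-holeless a q)

codeOf : Prog → ℕ
codeOf p = fillCode (holeless p) 0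

decode-codeOf : ∀ p → decode (codeOf p) ≡ p
decode-codeOf p = trans (decode-fillCode (holeless p) 0) (fill-holeless p _)

fillCode-computable : ∀ t → Computable (fillCode t)
fillCode-computable t =
  codeOf (fillCodeP t) ,
  λ x → subst (λ p → p ⟨ x ⟩⇓ fillCode t x) (sym (decode-codeOf (fillCodeP t))) (fillCodeP-⇓ t x)

-- Primitive recursive terms over an oracle

data Term : Set where
  Oₑ Zₑ Sₑ Iₑ Lₑ Rₑ : Term
  Cₑ Pₑ Recₑ : Term → Term → Term

mutual
  ev : (ℕ → ℕ) → Term → ℕ → ℕ
  ev o Oₑ x = o x
  ev o Zₑ x = 0
  ev o Sₑ x = suc x
  ev o Iₑ x = x
  ev o Lₑ x = proj₁ (unpair x)
  ev o Rₑ x = proj₂ (unpair x)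
  ev o (Cₑ f g) x = ev o f (ev o g x)
  ev o (Pₑ f g) x = pair (ev o f x) (ev o g x)
  ev o (Recₑ f g) x = evRec o f g (proj₁ (unpair x)) (proj₂ (unpair x))

  evRec : (ℕ → ℕ) → Term → Term → ℕ → ℕ → ℕ
  evRec o f g a zero = ev o f a
  evRec o f g a (suc n) = ev o g (pair a (pair n (evRec o f g a n)))

termTemplate : Term → Template
termTemplate Oₑ = hole
termTemplate Zₑ = zT
termTemplate Sₑ = sT
termTemplate Iₑ = iT
termTemplate Lₑ = lT
termTemplate Rₑ = rT
termTemplate (Cₑ f g) = compT (termTemplate f) (termTemplate g)
termTemplate (Pₑ f g) = pairT (termTemplate f) (termTemplate g)
termTemplate (Recₑ f g) = recT (termTemplate f) (termTemplate g)

module OracleProgram (o : ℕ → ℕ) (q : Prog) (q⇓o : ∀ n → q ⟨ n ⟩⇓ o n) where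
  mutual
    term-⇓ : ∀ t x → fill (termTemplate t) q ⟨ x ⟩⇓ ev o t x
    term-⇓ Oₑ x = q⇓o x
    term-⇓ Zₑ x = zE
    term-⇓ Sₑ x = sE
    term-⇓ Iₑ x = iE
    term-⇓ Lₑ x = lE
    term-⇓ Rₑ x = rE
    term-⇓ (Cₑ f g) x = compE (term-⇓ g x) (term-⇓ f (ev o g x))
    term-⇓ (Pₑ f g) x = pairE (term-⇓ f x) (term-⇓ g x)
    term-⇓ (Recₑ f g) x = recE (rec-⇓ f g _ _)

    rec-⇓ : ∀ f g a n → Rec (fill (termTemplate f) q) (fill (termTemplate g) q) a n (evRec o f g a n)
    rec-⇓ f g a zero = rec0 (term-⇓ f a)
    rec-⇓ f g a (suc n) = recS (rec-⇓ f g a n) (term-⇓ g _)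


-- Guarded programs and uniform reductions

predₑ : Term
predₑ = Cₑ (Recₑ Zₑ (Cₑ Lₑ Rₑ)) (Pₑ Zₑ Iₑ)

ev-predₑ : ∀ o x → ev o predₑ x ≡ pred x
ev-predₑ o x rewrite fst-pair 0 x | snd-pair 0 x with x
... | zero = refl
... | suc n = trans (cong (λ z → proj₁ (unpair z)) (snd-pair 0 (pair n w))) (fst-pair n w)
  where
  w : ℕ
  w = evRec o Zₑ (Cₑ Lₑ Rₑ) 0 n

predP : Prog
predP = fill (termTemplate predₑ) Zc

predP-⇓ : ∀ y → predP ⟨ y ⟩⇓ pred y
predP-⇓ y = subst (predP ⟨ y ⟩⇓_) (ev-predₑ (λ _ → 0) y) (OracleProgram.term-⇓ (λ _ → 0) Zc (λ _ → zE) predₑ y)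

-- μn. pred w: it halts (with 0) exactly when w ≤ 1.
guard : Template
guard = muT (compT (termTemplate predₑ) lT)

guard-⇓ : ∀ q w → w ≤ 1 → fill guard q ⟨ w ⟩⇓ 0
guard-⇓ q w w≤1 = muE (compE lE (subst (λ y → predP ⟨ y ⟩⇓ 0) (sym (fst-pair w 0)) (pred⇓0 w w≤1))) (λ m ())
  where
  pred⇓0 : ∀ w → w ≤ 1 → predP ⟨ w ⟩⇓ 0
  pred⇓0 zero _ = predP-⇓ 0
  pred⇓0 (suc zero) _ = predP-⇓ 1
  pred⇓0 (suc (suc _)) (s≤s ())

guard-⇓⇒≤1 : ∀ q w z → fill guard q ⟨ w ⟩⇓ z → w ≤ 1
guard-⇓⇒≤1 q w z (muE {n = n} (compE lE d) _) with ⇓-deterministic d (predP-⇓ _)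
... | pred[w]≡0 rewrite fst-pair w n with w
... | zero = z≤n
... | suc zero = s≤s z≤n

-- Besides running main, the oracle is queried at the input itself, only to make the program
-- diverge unless that answer is 0 or 1.
guarded : Term → Template
guarded main = compT lT (pairT (termTemplate main) (compT guard hole))

guarded-⇓ : ∀ o q → (∀ n → q ⟨ n ⟩⇓ o n) → (∀ n → o n ≤ 1) → ∀ main x → fill (guarded main) q ⟨ x ⟩⇓ ev o main x
guarded-⇓ o q q⇓o o≤1 main x = subst (fill (guarded main) q ⟨ x ⟩⇓_) (fst-pair (ev o main x) 0)
  (compE (pairE (OracleProgram.term-⇓ o q q⇓o main x) (compE (q⇓o x) (guard-⇓ q (o x) (o≤1 x)))) lE)

guarded-⇓⇒oracle≤1 : ∀ main q x v → fill (guarded main) q ⟨ x ⟩⇓ v → ∃ λ w → q ⟨ x ⟩⇓ w × w ≤ 1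
guarded-⇓⇒oracle≤1 main q x v (compE (pairE _ (compE {y = w} d g)) _) = w , d , guard-⇓⇒≤1 q w _ g

≤1⇒0⊎1 : ∀ {w} → w ≤ 1 → w ≡ 0 ⊎ w ≡ 1
≤1⇒0⊎1 {zero} _ = inj₁ refl
≤1⇒0⊎1 {suc zero} _ = inj₂ refl
≤1⇒0⊎1 {suc (suc _)} (s≤s ())

Onto : {X : Set} → (X → ℕ) → Set
Onto {X} c = ∀ n → Σ X λ x → c x ≡ n

RespectsEquivalence : {X : Set} {a : Level} → ((X → Set) → Set a) → Set (lsuc lzero ⊔ℓ a)
RespectsEquivalence {X} Pr = ∀ {S S' : X → Set} → (∀ x → S x ⇔ S' x) → Pr S → Pr S'

-- SNT and WELL are IndexSet (λ n → n) and IndexSet encodeSeq of the properties defined further down.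
IndexSet : {X : Set} {a : Level} → (X → ℕ) → ((X → Set) → Set a) → ℕ → Set (lsuc lzero ⊔ℓ a)
IndexSet {X} c Pr e = Σ (X → Set) λ S → IsCharFn c e S × Pr S

ZeroOneValued : ℕ → Set
ZeroOneValued e = ∀ n → φ e ⟨ n ⟩≃ 0 ⊎ φ e ⟨ n ⟩≃ 1

module _ {X : Set} {d : X → ℕ} (e : ℕ) where

  IsCharFn-values : (w : X → ℕ) → (∀ x → φ e ⟨ d x ⟩≃ w x) → (∀ x → w x ≤ 1) → IsCharFn d e (λ x → w x ≡ 1)
  IsCharFn-values w φ≃w w≤1 x with ≤1⇒0⊎1 (w≤1 x)
  ... | inj₁ w≡0 = (λ w≡1 → subst (φ e ⟨ d x ⟩≃_) w≡1 (φ≃w x)) , (λ _ → subst (φ e ⟨ d x ⟩≃_) w≡0 (φ≃w x))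
  ... | inj₂ w≡1 = (λ _ → subst (φ e ⟨ d x ⟩≃_) w≡1 (φ≃w x)) , (λ w≢1 → ⊥-elim (w≢1 w≡1))

  IsCharFn-unique : ExcludedMiddle lzero → ∀ {A : X → Set} (w : X → ℕ) →
                    IsCharFn d e A → (∀ x → φ e ⟨ d x ⟩≃ w x) → ∀ x → A x ⇔ (w x ≡ 1)
  IsCharFn-unique lem {A} w χ φ≃w x = mk⇔ (λ a → ⇓-deterministic (φ≃w x) (proj₁ (χ x) a)) back
    where
    back : w x ≡ 1 → A x
    back w≡1 with lem {P = A x}
    ... | yes a = a
    ... | no ¬a = ⊥-elim (0≢1+n (trans (sym (⇓-deterministic (φ≃w x) (proj₂ (χ x) ¬a))) w≡1))

  IsCharFn⇒ZeroOneValued : ExcludedMiddle lzero → ∀ {A : X → Set} → Onto d → IsCharFn d e A → ZeroOneValued e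
  IsCharFn⇒ZeroOneValued lem {A} d-onto χ n with d-onto n
  ... | x , refl with lem {P = A x}
  ... | yes a = inj₂ (proj₁ (χ x) a)
  ... | no ¬a = inj₁ (proj₂ (χ x) ¬a)

module ZeroOneValuedFunction (lem : ∀ {ℓ} → ExcludedMiddle ℓ) (e : ℕ) (e01 : ZeroOneValued e) where

  value : ℕ → ℕ
  value n with lem {P = φ e ⟨ n ⟩≃ 1}
  ... | yes _ = 1
  ... | no _ = 0

  value≤1 : ∀ n → value n ≤ 1
  value≤1 n with lem {P = φ e ⟨ n ⟩≃ 1}
  ... | yes _ = s≤s z≤n
  ... | no _ = z≤n

  φ≃value : ∀ n → φ e ⟨ n ⟩≃ value n
  φ≃value n with lem {P = φ e ⟨ n ⟩≃ 1} | e01 n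
  ... | yes φ≃1 | _ = φ≃1
  ... | no _ | inj₁ φ≃0 = φ≃0
  ... | no φ≄1 | inj₂ φ≃1 = ⊥-elim (φ≄1 φ≃1)

module UniformReduction (lem : ∀ {ℓ} → ExcludedMiddle ℓ)
  {X Y : Set} (c : X → ℕ) (c-onto : Onto c) (c' : Y → ℕ) (c'-onto : Onto c')
  {a b : Level} (Pr : (X → Set) → Set a) (Pr' : (Y → Set) → Set b)
  (Pr-resp : RespectsEquivalence Pr) (Pr'-resp : RespectsEquivalence Pr')
  (main : Term)
  (main≤1 : ∀ o → (∀ n → o n ≤ 1) → ∀ n → ev o main n ≤ 1)
  (main-correct : ∀ o → (∀ n → o n ≤ 1) → Pr (λ x → o (c x) ≡ 1) ⇔ Pr' (λ y → ev o main (c' y) ≡ 1))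
  where

  -- Opaque: unfolding the code red e during type checking is prohibitively expensive.
  opaque
    red : ℕ → ℕ
    red = fillCode (guarded main)

    red-computable : Computable red
    red-computable = fillCode-computable (guarded main)

    φ-red⁺ : ∀ e x v → fill (guarded main) (decode e) ⟨ x ⟩⇓ v → φ red e ⟨ x ⟩≃ v
    φ-red⁺ e x v = subst (λ p → p ⟨ x ⟩⇓ v) (sym (decode-fillCode (guarded main) e))

    φ-red⁻ : ∀ e x v → φ red e ⟨ x ⟩≃ v → fill (guarded main) (decode e) ⟨ x ⟩⇓ v
    φ-red⁻ e x v = subst (λ p → p ⟨ x ⟩⇓ v) (decode-fillCode (guarded main) e)

  φ-red-total : ∀ e {B : Y → Set} → IsCharFn c' (red e) B → ∀ y → ∃ λ v → φ red e ⟨ c' y ⟩≃ v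
  φ-red-total e {B} χ y with lem {P = B y}
  ... | yes b = 1 , proj₁ (χ y) b
  ... | no ¬b = 0 , proj₂ (χ y) ¬b

  IsCharFn-red⇒ZeroOneValued : ∀ e {B : Y → Set} → IsCharFn c' (red e) B → ZeroOneValued e
  IsCharFn-red⇒ZeroOneValued e χ n with c'-onto n
  ... | y , refl with φ-red-total e χ y
  ... | v , φ≃v with guarded-⇓⇒oracle≤1 main (decode e) (c' y) v (φ-red⁻ e (c' y) v φ≃v)
  ... | w , φ≃w , w≤1 with ≤1⇒0⊎1 w≤1
  ... | inj₁ refl = inj₁ φ≃w
  ... | inj₂ refl = inj₂ φ≃w

  module _ (e : ℕ) (e01 : ZeroOneValued e) where
    open ZeroOneValuedFunction lem e e01

    φ-red≃main : ∀ x → φ red e ⟨ x ⟩≃ ev value main x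
    φ-red≃main x = φ-red⁺ e x _ (guarded-⇓ value (decode e) φ≃value value≤1 main x)

    IsCharFn-e : IsCharFn c e (λ x → value (c x) ≡ 1)
    IsCharFn-e = IsCharFn-values e (λ x → value (c x)) (λ x → φ≃value (c x)) (λ x → value≤1 (c x))

    IsCharFn-red : IsCharFn c' (red e) (λ y → ev value main (c' y) ≡ 1)
    IsCharFn-red = IsCharFn-values (red e) (λ y → ev value main (c' y)) (λ y → φ-red≃main (c' y)) (λ y → main≤1 value value≤1 (c' y))

  reduction : IndexSet c Pr ≤m IndexSet c' Pr'
  reduction = red , red-computable , λ e → mk⇔ (forth e) (back e)
    where
    forth : ∀ e → IndexSet c Pr e → IndexSet c' Pr' (red e)
    forth e (A , χ , pr) = _ , IsCharFn-red e e01 ,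
        to (main-correct value value≤1) (Pr-resp (λ x → IsCharFn-unique e lem (λ x → value (c x)) χ (λ x → φ≃value (c x)) x) pr)
      where
      e01 : ZeroOneValued e
      e01 = IsCharFn⇒ZeroOneValued e lem c-onto χ
      open ZeroOneValuedFunction lem e e01
    back : ∀ e → IndexSet c' Pr' (red e) → IndexSet c Pr e
    back e (B , χ , pr') = _ , IsCharFn-e e e01 ,
        from (main-correct value value≤1) (Pr'-resp (λ y → IsCharFn-unique (red e) lem (λ y → ev value main (c' y)) χ (λ y → φ-red≃main e e01 (c' y)) y) pr')
      where
      e01 : ZeroOneValued e
      e01 = IsCharFn-red⇒ZeroOneValued e χ
      open ZeroOneValuedFunction lem e e01


-- Arithmetic by primitive recursion

iterN : (ℕ → ℕ) → ℕ → ℕ → ℕ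
iterN f zero s = s
iterN f (suc n) s = f (iterN f n s)

iterN-suc : ∀ (f : ℕ → ℕ) n s → iterN f (suc n) s ≡ iterN f n (f s)
iterN-suc f zero s = refl
iterN-suc f (suc n) s = cong f (iterN-suc f n s)

iterN-fixed : ∀ (f : ℕ → ℕ) s → f s ≡ s → ∀ n → iterN f n s ≡ s
iterN-fixed f s fs≡s zero = refl
iterN-fixed f s fs≡s (suc n) rewrite iterN-fixed f s fs≡s n = fs≡s

iterN-cong : ∀ {f g} → (∀ x → f x ≡ g x) → ∀ n s → iterN f n s ≡ iterN g n s
iterN-cong f≗g zero s = refl
iterN-cong {g = g} f≗g (suc n) s = trans (f≗g _) (cong g (iterN-cong f≗g n s))

iterN-+ : ∀ n s → iterN suc n s ≡ n + s
iterN-+ zero s = refl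
iterN-+ (suc n) s = cong suc (iterN-+ n s)

iterN-∸ : ∀ n s → iterN pred n s ≡ s ∸ n
iterN-∸ zero s = refl
iterN-∸ (suc n) s = trans (cong pred (iterN-∸ n s)) (pred[m∸n]≡m∸[1+n] s n)

iterₑ : Term → Term
iterₑ F = Recₑ Iₑ (Cₑ F (Cₑ Rₑ Rₑ))

ev-iterₑ : ∀ o F s n → ev o (iterₑ F) (pair s n) ≡ iterN (ev o F) n s
ev-iterₑ o F s n rewrite fst-pair s n | snd-pair s n = go n
  where
  go : ∀ n → evRec o Iₑ (Cₑ F (Cₑ Rₑ Rₑ)) s n ≡ iterN (ev o F) n s
  go zero = refl
  go (suc n) rewrite snd-pair s (pair n (evRec o Iₑ (Cₑ F (Cₑ Rₑ Rₑ)) s n))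
                   | snd-pair n (evRec o Iₑ (Cₑ F (Cₑ Rₑ Rₑ)) s n) = cong (ev o F) (go n)

caseN : ℕ → ℕ → (ℕ → ℕ) → ℕ
caseN zero a f = a
caseN (suc m) a f = f m

caseN-cong : ∀ c a {f g : ℕ → ℕ} → (∀ m → f m ≡ g m) → caseN c a f ≡ caseN c a g
caseN-cong zero a f≗g = refl
caseN-cong (suc m) a f≗g = f≗g m

caseₑ : Term → Term → Term
caseₑ A B = Recₑ A (Cₑ B (Pₑ Lₑ (Cₑ Lₑ Rₑ)))

ev-caseₑ : ∀ o A B d c → ev o (caseₑ A B) (pair d c) ≡ caseN c (ev o A d) (λ m → ev o B (pair d m))
ev-caseₑ o A B d c rewrite fst-pair d c | snd-pair d c with c
... | zero = refl
... | suc m rewrite fst-pair d (pair m (evRec o A (Cₑ B (Pₑ Lₑ (Cₑ Lₑ Rₑ))) d m))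
                  | snd-pair d (pair m (evRec o A (Cₑ B (Pₑ Lₑ (Cₑ Lₑ Rₑ))) d m))
                  | fst-pair m (evRec o A (Cₑ B (Pₑ Lₑ (Cₑ Lₑ Rₑ))) d m) = refl

constₑ : ℕ → Term
constₑ zero = Zₑ
constₑ (suc n) = Cₑ Sₑ (constₑ n)

ev-constₑ : ∀ o n x → ev o (constₑ n) x ≡ n
ev-constₑ o zero x = refl
ev-constₑ o (suc n) x = cong suc (ev-constₑ o n x)

addₑ subₑ : Term
addₑ = iterₑ Sₑ
subₑ = iterₑ predₑ

ev-addₑ : ∀ o a b → ev o addₑ (pair a b) ≡ b + a
ev-addₑ o a b = trans (ev-iterₑ o Sₑ a b) (iterN-+ b a)

ev-subₑ : ∀ o a b → ev o subₑ (pair a b) ≡ a ∸ b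
ev-subₑ o a b = trans (ev-iterₑ o predₑ a b) (trans (iterN-cong (ev-predₑ o) b a) (iterN-∸ b a))

-- Sequence codes

length≤encodeSeq : ∀ xs → length xs ≤ encodeSeq xs
length≤encodeSeq [] = z≤n
length≤encodeSeq (h ∷ t) = s≤s (≤-trans (length≤encodeSeq t) (y≤pair[x,y] h (encodeSeq t)))

-- The first argument is fuel; fuel n suffices for the code n.
decodeSeqF : ℕ → ℕ → List ℕ
decodeSeqF zero n = []
decodeSeqF (suc k) zero = []
decodeSeqF (suc k) (suc m) = proj₁ (unpair m) ∷ decodeSeqF k (proj₂ (unpair m))

decodeSeq : ℕ → List ℕ
decodeSeq n = decodeSeqF n n

encodeSeq-decodeSeqF : ∀ k n → n ≤ k → encodeSeq (decodeSeqF k n) ≡ n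
encodeSeq-decodeSeqF zero zero _ = refl
encodeSeq-decodeSeqF (suc k) zero _ = refl
encodeSeq-decodeSeqF (suc k) (suc m) (s≤s m≤k) = cong suc (begin
  pair (proj₁ (unpair m)) (encodeSeq (decodeSeqF k (proj₂ (unpair m))))
    ≡⟨ cong (pair (proj₁ (unpair m))) (encodeSeq-decodeSeqF k (proj₂ (unpair m)) (≤-trans (unpair₂≤ m) m≤k)) ⟩
  pair (proj₁ (unpair m)) (proj₂ (unpair m))
    ≡⟨ pair-unpair m ⟩
  m ∎)
  where open ≡-Reasoning

encodeSeq-decodeSeq : ∀ n → encodeSeq (decodeSeq n) ≡ n
encodeSeq-decodeSeq n = encodeSeq-decodeSeqF n n ≤-refl

encodeSeq-injective : ∀ xs ys → encodeSeq xs ≡ encodeSeq ys → xs ≡ ys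
encodeSeq-injective [] [] _ = refl
encodeSeq-injective (x ∷ xs) (y ∷ ys) e with pair-injective {x} {encodeSeq xs} {y} {encodeSeq ys} (suc-injective e)
... | refl , xs≡ys = cong (x ∷_) (encodeSeq-injective xs ys xs≡ys)

decodeSeq-encodeSeq : ∀ xs → decodeSeq (encodeSeq xs) ≡ xs
decodeSeq-encodeSeq xs = encodeSeq-injective _ _ (encodeSeq-decodeSeq (encodeSeq xs))

-- Folding over a sequence code: the state is pair l acc, where l codes the rest of the list.
foldStep : (ℕ → ℕ → ℕ) → ℕ → ℕ
foldStep f s = caseN (proj₁ (unpair s)) s (λ m → pair (proj₂ (unpair m)) (f (proj₁ (unpair m)) (proj₂ (unpair s))))

foldCode : (ℕ → ℕ → ℕ) → ℕ → ℕ → ℕ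
foldCode f l a = proj₂ (unpair (iterN (foldStep f) l (pair l a)))

foldStep-[] : ∀ f a → foldStep f (pair 0 a) ≡ pair 0 a
foldStep-[] f a rewrite fst-pair 0 a = refl

foldStep-∷ : ∀ f h t a → foldStep f (pair (encodeSeq (h ∷ t)) a) ≡ pair (encodeSeq t) (f h a)
foldStep-∷ f h t a rewrite fst-pair (suc (pair h (encodeSeq t))) a | snd-pair (suc (pair h (encodeSeq t))) a
  | fst-pair h (encodeSeq t) | snd-pair h (encodeSeq t) = refl

iterN-foldStep : ∀ f xs a n → length xs ≤ n →
                 iterN (foldStep f) n (pair (encodeSeq xs) a) ≡ pair 0 (foldl (λ acc h → f h acc) a xs)
iterN-foldStep f [] a n _ = iterN-fixed (foldStep f) (pair 0 a) (foldStep-[] f a) n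
iterN-foldStep f (h ∷ t) a (suc n) (s≤s |t|≤n)
  rewrite iterN-suc (foldStep f) n (pair (encodeSeq (h ∷ t)) a) | foldStep-∷ f h t a = iterN-foldStep f t (f h a) n |t|≤n

foldCode-encodeSeq : ∀ f xs a → foldCode f (encodeSeq xs) a ≡ foldl (λ acc h → f h acc) a xs
foldCode-encodeSeq f xs a rewrite iterN-foldStep f xs a (encodeSeq xs) (length≤encodeSeq xs) = snd-pair 0 _

-- Expressions with variables, compiled to terms

b2n : Bool → ℕ
b2n true = 1
b2n false = 0

b2n≤1 : ∀ p → b2n p ≤ 1
b2n≤1 true = s≤s z≤n
b2n≤1 false = z≤n

isZero : ℕ → ℕ
isZero n = caseN n 1 (λ _ → 0)

isZero-distance : ∀ a b → isZero ((a ∸ b) + (b ∸ a)) ≡ b2n (a ≡ᵇ b)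
isZero-distance zero zero = refl
isZero-distance zero (suc b) = refl
isZero-distance (suc a) zero = refl
isZero-distance (suc a) (suc b) = isZero-distance a b

data Expr : Set where
  var : ℕ → Expr
  lit : ℕ → Expr
  add sub eq pr : Expr → Expr → Expr
  fst snd orc : Expr → Expr
  ifz : Expr → Expr → Expr → Expr
  fold : Expr → Expr → Expr → Expr

lookupOr0 : List ℕ → ℕ → ℕ
lookupOr0 [] i = 0
lookupOr0 (v ∷ ρ) zero = v
lookupOr0 (v ∷ ρ) (suc i) = lookupOr0 ρ i

-- In fold l a b, the body b sees the current element as var 0 and the accumulator as var 1.
eval : (ℕ → ℕ) → List ℕ → Expr → ℕ
eval o ρ (var i) = lookupOr0 ρ i
eval o ρ (lit n) = n
eval o ρ (add a b) = eval o ρ a + eval o ρ b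
eval o ρ (sub a b) = eval o ρ a ∸ eval o ρ b
eval o ρ (eq a b) = b2n (eval o ρ a ≡ᵇ eval o ρ b)
eval o ρ (pr a b) = pair (eval o ρ a) (eval o ρ b)
eval o ρ (fst a) = proj₁ (unpair (eval o ρ a))
eval o ρ (snd a) = proj₂ (unpair (eval o ρ a))
eval o ρ (orc a) = o (eval o ρ a)
eval o ρ (ifz c a b) = caseN (eval o ρ c) (eval o ρ a) (λ _ → eval o ρ b)
eval o ρ (fold l a b) = foldCode (λ h acc → eval o (h ∷ acc ∷ ρ) b) (eval o ρ l) (eval o ρ a)

encodeEnv : List ℕ → ℕ
encodeEnv [] = 0
encodeEnv (v ∷ ρ) = pair v (encodeEnv ρ)

varₑ : ℕ → Term
varₑ zero = Lₑ
varₑ (suc i) = Cₑ (varₑ i) Rₑ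

ev-varₑ : ∀ o ρ i → ev o (varₑ i) (encodeEnv ρ) ≡ lookupOr0 ρ i
ev-varₑ o [] zero = refl
ev-varₑ o [] (suc i) = ev-varₑ o [] i
ev-varₑ o (v ∷ ρ) zero = fst-pair v (encodeEnv ρ)
ev-varₑ o (v ∷ ρ) (suc i) rewrite snd-pair v (encodeEnv ρ) = ev-varₑ o ρ i

-- These act on pair env s, with s a fold state; G receives pair env (pair h acc).
foldBranchₑ : Term → Term
foldBranchₑ G = Pₑ (Cₑ Lₑ Lₑ) (Pₑ (Cₑ Rₑ Rₑ) (Cₑ G (Pₑ (Cₑ Lₑ Lₑ) (Pₑ (Cₑ Lₑ Rₑ) (Cₑ Rₑ (Cₑ Rₑ Lₑ))))))

foldStepₑ : Term → Term
foldStepₑ G = Cₑ (caseₑ Iₑ (foldBranchₑ G)) (Pₑ Iₑ (Cₑ Lₑ Rₑ))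

foldₑ : Term → Term
foldₑ G = Cₑ (Cₑ Rₑ Rₑ) (Cₑ (iterₑ (foldStepₑ G)) (Pₑ Iₑ (Cₑ Lₑ Rₑ)))

foldBodyₑ : Term → Term
foldBodyₑ b = Cₑ b (Pₑ (Cₑ Lₑ Rₑ) (Pₑ (Cₑ Rₑ Rₑ) Lₑ))

compile : Expr → Term
compile (var i) = varₑ i
compile (lit n) = constₑ n
compile (add a b) = Cₑ addₑ (Pₑ (compile b) (compile a))
compile (sub a b) = Cₑ subₑ (Pₑ (compile a) (compile b))
compile (eq a b) = Cₑ (caseₑ (constₑ 1) Zₑ) (Pₑ Zₑ (Cₑ addₑ (Pₑ (Cₑ subₑ (Pₑ (compile a) (compile b))) (Cₑ subₑ (Pₑ (compile b) (compile a))))))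
compile (pr a b) = Pₑ (compile a) (compile b)
compile (fst a) = Cₑ Lₑ (compile a)
compile (snd a) = Cₑ Rₑ (compile a)
compile (orc a) = Cₑ Oₑ (compile a)
compile (ifz c a b) = Cₑ (caseₑ (compile a) (Cₑ (compile b) Lₑ)) (Pₑ Iₑ (compile c))
compile (fold l a b) = Cₑ (foldₑ (foldBodyₑ (compile b))) (Pₑ Iₑ (Pₑ (compile l) (compile a)))

module _ (o : ℕ → ℕ) (G : Term) (env : ℕ) (f : ℕ → ℕ → ℕ) (G≗f : ∀ h acc → ev o G (pair env (pair h acc)) ≡ f h acc) where

  ev-foldStepₑ : ∀ s → ev o (foldStepₑ G) (pair env s) ≡ pair env (foldStep f s)
  ev-foldStepₑ s rewrite snd-pair env s with proj₁ (unpair s)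
  ... | zero rewrite ev-caseₑ o Iₑ (foldBranchₑ G) (pair env s) 0 = refl
  ... | suc m rewrite ev-caseₑ o Iₑ (foldBranchₑ G) (pair env s) (suc m)
        | fst-pair (pair env s) m | snd-pair (pair env s) m | fst-pair env s | snd-pair env s
        = cong (pair env) (cong (pair (proj₂ (unpair m))) (G≗f (proj₁ (unpair m)) (proj₂ (unpair s))))

  iterN-foldStepₑ : ∀ n s → iterN (ev o (foldStepₑ G)) n (pair env s) ≡ pair env (iterN (foldStep f) n s)
  iterN-foldStepₑ zero s = refl
  iterN-foldStepₑ (suc n) s rewrite iterN-foldStepₑ n s = ev-foldStepₑ (iterN (foldStep f) n s)

  ev-foldₑ : ∀ l a → ev o (foldₑ G) (pair env (pair l a)) ≡ foldCode f l a
  ev-foldₑ l a rewrite snd-pair env (pair l a) | fst-pair l a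
    | ev-iterₑ o (foldStepₑ G) (pair env (pair l a)) l | iterN-foldStepₑ l (pair l a)
    | snd-pair env (iterN (foldStep f) l (pair l a)) = refl

mutual
  compile-correct : ∀ o ρ t → ev o (compile t) (encodeEnv ρ) ≡ eval o ρ t
  compile-correct o ρ (var i) = ev-varₑ o ρ i
  compile-correct o ρ (lit n) = ev-constₑ o n _
  compile-correct o ρ (add a b) rewrite ev-addₑ o (ev o (compile b) (encodeEnv ρ)) (ev o (compile a) (encodeEnv ρ)) =
    cong₂ _+_ (compile-correct o ρ a) (compile-correct o ρ b)
  compile-correct o ρ (sub a b) rewrite ev-subₑ o (ev o (compile a) (encodeEnv ρ)) (ev o (compile b) (encodeEnv ρ)) =
    cong₂ _∸_ (compile-correct o ρ a) (compile-correct o ρ b)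
  compile-correct o ρ (eq a b)
    rewrite ev-subₑ o (ev o (compile a) (encodeEnv ρ)) (ev o (compile b) (encodeEnv ρ))
          | ev-subₑ o (ev o (compile b) (encodeEnv ρ)) (ev o (compile a) (encodeEnv ρ))
          | ev-addₑ o (ev o (compile a) (encodeEnv ρ) ∸ ev o (compile b) (encodeEnv ρ))
                      (ev o (compile b) (encodeEnv ρ) ∸ ev o (compile a) (encodeEnv ρ))
          | ev-caseₑ o (constₑ 1) Zₑ 0 ((ev o (compile b) (encodeEnv ρ) ∸ ev o (compile a) (encodeEnv ρ))
                                        + (ev o (compile a) (encodeEnv ρ) ∸ ev o (compile b) (encodeEnv ρ)))
          | compile-correct o ρ a | compile-correct o ρ b
          | +-comm (eval o ρ b ∸ eval o ρ a) (eval o ρ a ∸ eval o ρ b)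
    = isZero-distance (eval o ρ a) (eval o ρ b)
  compile-correct o ρ (pr a b) = cong₂ pair (compile-correct o ρ a) (compile-correct o ρ b)
  compile-correct o ρ (fst a) = cong (λ z → proj₁ (unpair z)) (compile-correct o ρ a)
  compile-correct o ρ (snd a) = cong (λ z → proj₂ (unpair z)) (compile-correct o ρ a)
  compile-correct o ρ (orc a) = cong o (compile-correct o ρ a)
  compile-correct o ρ (ifz c a b)
    rewrite ev-caseₑ o (compile a) (Cₑ (compile b) Lₑ) (encodeEnv ρ) (ev o (compile c) (encodeEnv ρ))
          | compile-correct o ρ c | compile-correct o ρ a
    = caseN-cong (eval o ρ c) (eval o ρ a) λ m →
        trans (cong (ev o (compile b)) (fst-pair (encodeEnv ρ) m)) (compile-correct o ρ b)
  compile-correct o ρ (fold l a b)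
    rewrite ev-foldₑ o (foldBodyₑ (compile b)) (encodeEnv ρ) (λ h acc → eval o (h ∷ acc ∷ ρ) b) (foldBody-correct o ρ b)
                     (ev o (compile l) (encodeEnv ρ)) (ev o (compile a) (encodeEnv ρ))
          | compile-correct o ρ l | compile-correct o ρ a = refl

  foldBody-correct : ∀ o ρ b h acc → ev o (foldBodyₑ (compile b)) (pair (encodeEnv ρ) (pair h acc)) ≡ eval o (h ∷ acc ∷ ρ) b
  foldBody-correct o ρ b h acc
    rewrite snd-pair (encodeEnv ρ) (pair h acc) | fst-pair h acc | snd-pair h acc | fst-pair (encodeEnv ρ) (pair h acc)
    = compile-correct o (h ∷ acc ∷ ρ) b

infix  4 _≐_
infixr 3 _∧ᴮ_
infixr 2 _∨ᴮ_ _⇒ᴮ_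

data BExpr : Set where
  _≐_ : Expr → Expr → BExpr
  _∧ᴮ_ _∨ᴮ_ : BExpr → BExpr → BExpr
  ¬ᴮ : BExpr → BExpr

_⇒ᴮ_ : BExpr → BExpr → BExpr
p ⇒ᴮ q = ¬ᴮ p ∨ᴮ q

evalB : (ℕ → ℕ) → List ℕ → BExpr → Bool
evalB o ρ (a ≐ b) = eval o ρ a ≡ᵇ eval o ρ b
evalB o ρ (p ∧ᴮ q) = evalB o ρ p ∧ evalB o ρ q
evalB o ρ (p ∨ᴮ q) = evalB o ρ p ∨ evalB o ρ q
evalB o ρ (¬ᴮ p) = not (evalB o ρ p)

toExpr : BExpr → Expr
toExpr (a ≐ b) = eq a b
toExpr (p ∧ᴮ q) = ifz (toExpr p) (lit 0) (toExpr q)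
toExpr (p ∨ᴮ q) = ifz (toExpr p) (toExpr q) (lit 1)
toExpr (¬ᴮ p) = ifz (toExpr p) (lit 1) (lit 0)

eval-toExpr : ∀ o ρ p → eval o ρ (toExpr p) ≡ b2n (evalB o ρ p)
eval-toExpr o ρ (a ≐ b) = refl
eval-toExpr o ρ (p ∧ᴮ q) rewrite eval-toExpr o ρ p with evalB o ρ p
... | true = eval-toExpr o ρ q
... | false = refl
eval-toExpr o ρ (p ∨ᴮ q) rewrite eval-toExpr o ρ p with evalB o ρ p
... | true = refl
... | false = eval-toExpr o ρ q
eval-toExpr o ρ (¬ᴮ p) rewrite eval-toExpr o ρ p with evalB o ρ p
... | true = refl
... | false = refl

b2n-≡ᵇ1 : ∀ p → (b2n p ≡ᵇ 1) ≡ p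
b2n-≡ᵇ1 true = refl
b2n-≡ᵇ1 false = refl

fst-pair-≡ᵇ1 : ∀ p b → (proj₁ (unpair (pair (b2n p) b)) ≡ᵇ 1) ≡ p
fst-pair-≡ᵇ1 p b = trans (cong (_≡ᵇ 1) (fst-pair (b2n p) b)) (b2n-≡ᵇ1 p)

snd-pair-≡ᵇ1 : ∀ a p → (proj₂ (unpair (pair a (b2n p))) ≡ᵇ 1) ≡ p
snd-pair-≡ᵇ1 a p = trans (cong (_≡ᵇ 1) (snd-pair a (b2n p))) (b2n-≡ᵇ1 p)

-- Placements

-- A placement puts the tile tileN s at the point (x⁺ s ⊖ x⁻ s , y⁺ s ⊖ y⁻ s).
x⁺ x⁻ y⁺ y⁻ tileN : ℕ → ℕ
x⁺ s = proj₁ (unpair (proj₁ (unpair (proj₁ (unpair s)))))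
x⁻ s = proj₂ (unpair (proj₁ (unpair (proj₁ (unpair s)))))
y⁺ s = proj₁ (unpair (proj₂ (unpair (proj₁ (unpair s)))))
y⁻ s = proj₂ (unpair (proj₂ (unpair (proj₁ (unpair s)))))
tileN s = proj₂ (unpair s)

-- offsetB dx dy a b: pos b is pos a shifted by (dx , dy).
offsetB : ℕ → ℕ → ℕ → ℕ → Bool
offsetB dx dy a b = (x⁺ b + x⁻ a ≡ᵇ (x⁺ a + dx) + x⁻ b) ∧ (y⁺ b + y⁻ a ≡ᵇ (y⁺ a + dy) + y⁻ b)

rightOfB aboveB sameB adjB compatB : ℕ → ℕ → Bool
rightOfB = offsetB 1 0
aboveB = offsetB 0 1
sameB = offsetB 0 0
adjB a b = rightOfB a b ∨ rightOfB b a ∨ aboveB a b ∨ aboveB b a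
compatB a b = not (sameB a b) ∧
  (not (rightOfB a b) ∨ (right (tileN a) ≡ᵇ left (tileN b))) ∧
  (not (rightOfB b a) ∨ (right (tileN b) ≡ᵇ left (tileN a))) ∧
  (not (aboveB a b) ∨ (up (tileN a) ≡ᵇ bottom (tileN b))) ∧
  (not (aboveB b a) ∨ (up (tileN b) ≡ᵇ bottom (tileN a)))

okB : (ℕ → ℕ) → List ℕ → ℕ → Bool
okB o r s = (o (tileN s) ≡ᵇ 1) ∧ (null r ∨ any (adjB s) r) ∧ all (compatB s) r

-- r lists the earlier placements, most recent first.
checkL : (ℕ → ℕ) → List ℕ → List ℕ → Bool
checkL o r [] = true
checkL o r (s ∷ xs) = okB o r s ∧ checkL o (s ∷ r) xs

x⁺ᴱ x⁻ᴱ y⁺ᴱ y⁻ᴱ tileᴱ leftᴱ upᴱ rightᴱ bottomᴱ : Expr → Expr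
x⁺ᴱ s = fst (fst (fst s))
x⁻ᴱ s = snd (fst (fst s))
y⁺ᴱ s = fst (snd (fst s))
y⁻ᴱ s = snd (snd (fst s))
tileᴱ s = snd s
leftᴱ t = fst t
upᴱ t = fst (snd t)
rightᴱ t = fst (snd (snd t))
bottomᴱ t = snd (snd (snd t))

-- evalB o ρ (rightOfᴮ a b) is definitionally rightOfB (eval o ρ a) (eval o ρ b); likewise for the others.
offsetᴮ : ℕ → ℕ → Expr → Expr → BExpr
offsetᴮ dx dy a b = (add (x⁺ᴱ b) (x⁻ᴱ a) ≐ add (add (x⁺ᴱ a) (lit dx)) (x⁻ᴱ b)) ∧ᴮ
                    (add (y⁺ᴱ b) (y⁻ᴱ a) ≐ add (add (y⁺ᴱ a) (lit dy)) (y⁻ᴱ b))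

rightOfᴮ aboveᴮ sameᴮ adjᴮ compatᴮ : Expr → Expr → BExpr
rightOfᴮ = offsetᴮ 1 0
aboveᴮ = offsetᴮ 0 1
sameᴮ = offsetᴮ 0 0
adjᴮ a b = rightOfᴮ a b ∨ᴮ rightOfᴮ b a ∨ᴮ aboveᴮ a b ∨ᴮ aboveᴮ b a
compatᴮ a b = ¬ᴮ (sameᴮ a b) ∧ᴮ
  (rightOfᴮ a b ⇒ᴮ rightᴱ (tileᴱ a) ≐ leftᴱ (tileᴱ b)) ∧ᴮ
  (rightOfᴮ b a ⇒ᴮ rightᴱ (tileᴱ b) ≐ leftᴱ (tileᴱ a)) ∧ᴮ
  (aboveᴮ a b ⇒ᴮ upᴱ (tileᴱ a) ≐ bottomᴱ (tileᴱ b)) ∧ᴮ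
  (aboveᴮ b a ⇒ᴮ upᴱ (tileᴱ b) ≐ bottomᴱ (tileᴱ a))

-- The outer fold runs over the placements with accumulator pair (encodeSeq r) flag;
-- the inner fold runs over r with accumulator pair (any adjacent) (all compatible).
adjCompatBody adjCompatD : Expr
adjCompatBody = pr (toExpr ((fst (var 1) ≐ lit 1) ∨ᴮ adjᴮ (var 2) (var 0)))
                   (toExpr ((snd (var 1) ≐ lit 1) ∧ᴮ compatᴮ (var 2) (var 0)))
adjCompatD = fold (fst (var 1)) (pr (lit 0) (lit 1)) adjCompatBody

okᴮ : BExpr
okᴮ = (orc (tileᴱ (var 0)) ≐ lit 1) ∧ᴮ ((fst (var 1) ≐ lit 0) ∨ᴮ (fst adjCompatD ≐ lit 1)) ∧ᴮ (snd adjCompatD ≐ lit 1)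

outerBody checkD : Expr
outerBody = pr (add (lit 1) (pr (var 0) (fst (var 1)))) (toExpr ((snd (var 1) ≐ lit 1) ∧ᴮ okᴮ))
checkD = snd (fold (var 0) (pr (lit 0) (lit 1)) outerBody)

encodeSeq-≡ᵇ0 : ∀ r → (encodeSeq r ≡ᵇ 0) ≡ null r
encodeSeq-≡ᵇ0 [] = refl
encodeSeq-≡ᵇ0 (_ ∷ _) = refl

module CheckD (o : ℕ → ℕ) where

  adjCompat-step : ∀ s acc ρ h p q → eval o (h ∷ pair (b2n p) (b2n q) ∷ s ∷ acc ∷ ρ) adjCompatBody ≡
                                     pair (b2n (p ∨ adjB s h)) (b2n (q ∧ compatB s h))
  adjCompat-step s acc ρ h p q = cong₂ pair
    (trans (eval-toExpr o env ((fst (var 1) ≐ lit 1) ∨ᴮ adjᴮ (var 2) (var 0)))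
           (cong (λ z → b2n (z ∨ adjB s h)) (fst-pair-≡ᵇ1 p (b2n q))))
    (trans (eval-toExpr o env ((snd (var 1) ≐ lit 1) ∧ᴮ compatᴮ (var 2) (var 0)))
           (cong (λ z → b2n (z ∧ compatB s h)) (snd-pair-≡ᵇ1 (b2n p) q)))
    where
    env : List ℕ
    env = h ∷ pair (b2n p) (b2n q) ∷ s ∷ acc ∷ ρ

  adjCompat-fold : ∀ s acc ρ ys p q →
    foldl (λ acc' h → eval o (h ∷ acc' ∷ s ∷ acc ∷ ρ) adjCompatBody) (pair (b2n p) (b2n q)) ys
      ≡ pair (b2n (p ∨ any (adjB s) ys)) (b2n (q ∧ all (compatB s) ys))
  adjCompat-fold s acc ρ [] p q rewrite ∨-identityʳ p | ∧-identityʳ q = refl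
  adjCompat-fold s acc ρ (y ∷ ys) p q
    rewrite adjCompat-step s acc ρ y p q | adjCompat-fold s acc ρ ys (p ∨ adjB s y) (q ∧ compatB s y)
          | ∨-assoc p (adjB s y) (any (adjB s) ys) | ∧-assoc q (compatB s y) (all (compatB s) ys) = refl

  eval-adjCompatD : ∀ s r fl ρ → eval o (s ∷ pair (encodeSeq r) fl ∷ ρ) adjCompatD ≡
                                 pair (b2n (any (adjB s) r)) (b2n (all (compatB s) r))
  eval-adjCompatD s r fl ρ rewrite fst-pair (encodeSeq r) fl
    | foldCode-encodeSeq (λ h acc → eval o (h ∷ acc ∷ s ∷ pair (encodeSeq r) fl ∷ ρ) adjCompatBody) r (pair 0 1)
    = adjCompat-fold s (pair (encodeSeq r) fl) ρ r false true

  outer-step : ∀ s r fl ρ → eval o (s ∷ pair (encodeSeq r) (b2n fl) ∷ ρ) outerBody ≡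
                            pair (encodeSeq (s ∷ r)) (b2n (fl ∧ okB o r s))
  outer-step s r fl ρ = cong₂ pair (cong (λ z → suc (pair s z)) (fst-pair (encodeSeq r) (b2n fl)))
    (trans (eval-toExpr o env ((snd (var 1) ≐ lit 1) ∧ᴮ okᴮ)) (cong b2n (cong₂ (λ u v → u ∧ (o (tileN s) ≡ᵇ 1) ∧ v)
      (snd-pair-≡ᵇ1 (encodeSeq r) fl)
      (cong₂ _∧_ (cong₂ _∨_ (trans (cong (_≡ᵇ 0) (fst-pair (encodeSeq r) (b2n fl))) (encodeSeq-≡ᵇ0 r))
                            (trans (cong (λ z → proj₁ (unpair z) ≡ᵇ 1) adjCompat) (fst-pair-≡ᵇ1 (any (adjB s) r) (b2n (all (compatB s) r)))))
                 (trans (cong (λ z → proj₂ (unpair z) ≡ᵇ 1) adjCompat) (snd-pair-≡ᵇ1 (b2n (any (adjB s) r)) (all (compatB s) r)))))))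
    where
    env : List ℕ
    env = s ∷ pair (encodeSeq r) (b2n fl) ∷ ρ
    adjCompat : eval o env adjCompatD ≡ pair (b2n (any (adjB s) r)) (b2n (all (compatB s) r))
    adjCompat = eval-adjCompatD s r (b2n fl) ρ

  outer-fold : ∀ ρ xs r fl →
    foldl (λ acc h → eval o (h ∷ acc ∷ ρ) outerBody) (pair (encodeSeq r) (b2n fl)) xs
      ≡ pair (encodeSeq (reverse xs ++ r)) (b2n (fl ∧ checkL o r xs))
  outer-fold ρ [] r fl rewrite ∧-identityʳ fl = refl
  outer-fold ρ (s ∷ xs) r fl rewrite outer-step s r fl ρ | outer-fold ρ xs (s ∷ r) (fl ∧ okB o r s)
    | ∧-assoc fl (okB o r s) (checkL o (s ∷ r) xs)
    | unfold-reverse s xs | ++-assoc (reverse xs) [ s ] r = refl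

  eval-checkD : ∀ xs → eval o [ encodeSeq xs ] checkD ≡ b2n (checkL o [] xs)
  eval-checkD xs rewrite foldCode-encodeSeq (λ h acc → eval o (h ∷ acc ∷ [ encodeSeq xs ]) outerBody) xs (pair 0 1)
    | outer-fold [ encodeSeq xs ] xs [] true = snd-pair (encodeSeq (reverse xs ++ [])) (b2n (checkL o [] xs))


+≡+⇒⊖≡⊖ : ∀ a b c d → a + d ≡ c + b → a ⊖ b ≡ c ⊖ d
+≡+⇒⊖≡⊖ a b c d a+d≡c+b = begin
  a ⊖ b               ≡⟨ sym (ℤP.+-cancelˡ-⊖ d a b) ⟩
  (d + a) ⊖ (d + b)   ≡⟨ cong₂ _⊖_ (trans (+-comm d a) (trans a+d≡c+b (+-comm c b))) (+-comm d b) ⟩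
  (b + c) ⊖ (b + d)   ≡⟨ ℤP.+-cancelˡ-⊖ b c d ⟩
  c ⊖ d               ∎
  where open ≡-Reasoning

⊖≡⊖⇒+≡+ : ∀ a b c d → a ⊖ b ≡ c ⊖ d → a + d ≡ c + b
⊖≡⊖⇒+≡+ a b c d a⊖b≡c⊖d = ℤP.+-injective (begin
  + a +ℤ + d                   ≡⟨ sym (cancel (+ a) (+ b) (+ d)) ⟩
  (+ a - + b) +ℤ (+ b +ℤ + d)  ≡⟨ cong (_+ℤ (+ b +ℤ + d)) a-b≡c-d ⟩
  (+ c - + d) +ℤ (+ b +ℤ + d)  ≡⟨ cong ((+ c - + d) +ℤ_) (ℤP.+-comm (+ b) (+ d)) ⟩
  (+ c - + d) +ℤ (+ d +ℤ + b)  ≡⟨ cancel (+ c) (+ d) (+ b) ⟩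
  + c +ℤ + b                   ∎)
  where
  open ≡-Reasoning
  open +-*-Solver
  cancel : ∀ (x y z : ℤ) → (x - y) +ℤ (y +ℤ z) ≡ x +ℤ z
  cancel = solve 3 (λ x y z → (x :- y) :+ (y :+ z) := x :+ z) refl
  a-b≡c-d : + a - + b ≡ + c - + d
  a-b≡c-d = trans (ℤP.[+m]-[+n]≡m⊖n a b) (trans a⊖b≡c⊖d (sym (ℤP.[+m]-[+n]≡m⊖n c d)))

T-∧⁻ : ∀ x {y} → T (x ∧ y) → T x × T y
T-∧⁻ x = to (T-∧ {x})

T-∧⁺ : ∀ {x y} → T x → T y → T (x ∧ y)
T-∧⁺ tx ty = from T-∧ (tx , ty)

T-∨⁻ : ∀ x {y} → T (x ∨ y) → T x ⊎ T y
T-∨⁻ x = to (T-∨ {x})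

T-∨⁺ˡ : ∀ {x} y → T x → T (x ∨ y)
T-∨⁺ˡ y tx = from T-∨ (inj₁ tx)

T-∨⁺ʳ : ∀ x {y} → T y → T (x ∨ y)
T-∨⁺ʳ x ty = from (T-∨ {x}) (inj₂ ty)

T-not⁺ : ∀ {b} → ¬ T b → T (not b)
T-not⁺ {true} ¬tb = ¬tb tt
T-not⁺ {false} _ = tt

T-not⁻ : ∀ {b} → T (not b) → ¬ T b
T-not⁻ {true} ()

T-⇒⁺ : ∀ {b c} → (T b → T c) → T (not b ∨ c)
T-⇒⁺ {true} tb⇒tc = tb⇒tc tt
T-⇒⁺ {false} _ = tt

T-⇒⁻ : ∀ {b c} → T (not b ∨ c) → T b → T c
T-⇒⁻ {true} tc _ = tc

≡ᵇ⇒≡′ : ∀ {m n} → T (m ≡ᵇ n) → m ≡ n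
≡ᵇ⇒≡′ {m} {n} = ≡ᵇ⇒≡ m n

≡⇒≡ᵇ′ : ∀ {m n} → m ≡ n → T (m ≡ᵇ n)
≡⇒≡ᵇ′ {m} {n} = ≡⇒≡ᵇ m n

pos : ℕ → Point
pos s = (x⁺ s ⊖ x⁻ s , y⁺ s ⊖ y⁻ s)

shift : ℕ → ℕ → ℕ → Point
shift dx dy a = ((x⁺ a + dx) ⊖ x⁻ a , (y⁺ a + dy) ⊖ y⁻ a)

offsetB⇔ : ∀ dx dy a b → T (offsetB dx dy a b) ⇔ pos b ≡ shift dx dy a
offsetB⇔ dx dy a b = mk⇔ forth back
  where
  forth : T (offsetB dx dy a b) → pos b ≡ shift dx dy a
  forth t with T-∧⁻ (x⁺ b + x⁻ a ≡ᵇ (x⁺ a + dx) + x⁻ b) t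
  ... | tx , ty = ×-≡,≡→≡ (+≡+⇒⊖≡⊖ (x⁺ b) (x⁻ b) (x⁺ a + dx) (x⁻ a) (≡ᵇ⇒≡′ tx) ,
                           +≡+⇒⊖≡⊖ (y⁺ b) (y⁻ b) (y⁺ a + dy) (y⁻ a) (≡ᵇ⇒≡′ ty))
  back : pos b ≡ shift dx dy a → T (offsetB dx dy a b)
  back e with ×-≡,≡←≡ e
  ... | ex , ey = T-∧⁺ (≡⇒≡ᵇ′ (⊖≡⊖⇒+≡+ (x⁺ b) (x⁻ b) (x⁺ a + dx) (x⁻ a) ex))
                       (≡⇒≡ᵇ′ (⊖≡⊖⇒+≡+ (y⁺ b) (y⁻ b) (y⁺ a + dy) (y⁻ a) ey))

stepRight stepUp : Point → Point
stepRight (x , y) = (x +ℤ one , y)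
stepUp (x , y) = (x , y +ℤ one)

shift-1-0 : ∀ a → shift 1 0 a ≡ stepRight (pos a)
shift-1-0 a = cong₂ _,_ (sym (ℤP.distribˡ-⊖-+-pos 1 (x⁺ a) (x⁻ a))) (cong (_⊖ y⁻ a) (+-identityʳ (y⁺ a)))

shift-0-1 : ∀ a → shift 0 1 a ≡ stepUp (pos a)
shift-0-1 a = cong₂ _,_ (cong (_⊖ x⁻ a) (+-identityʳ (x⁺ a))) (sym (ℤP.distribˡ-⊖-+-pos 1 (y⁺ a) (y⁻ a)))

shift-0-0 : ∀ a → shift 0 0 a ≡ pos a
shift-0-0 a = cong₂ _,_ (cong (_⊖ x⁻ a) (+-identityʳ (x⁺ a))) (cong (_⊖ y⁻ a) (+-identityʳ (y⁺ a)))

rightOfB⇔ : ∀ a b → T (rightOfB a b) ⇔ pos b ≡ stepRight (pos a)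
rightOfB⇔ a b = subst (λ q → T (rightOfB a b) ⇔ pos b ≡ q) (shift-1-0 a) (offsetB⇔ 1 0 a b)

aboveB⇔ : ∀ a b → T (aboveB a b) ⇔ pos b ≡ stepUp (pos a)
aboveB⇔ a b = subst (λ q → T (aboveB a b) ⇔ pos b ≡ q) (shift-0-1 a) (offsetB⇔ 0 1 a b)

sameB⇔ : ∀ a b → T (sameB a b) ⇔ pos b ≡ pos a
sameB⇔ a b = subst (λ q → T (sameB a b) ⇔ pos b ≡ q) (shift-0-0 a) (offsetB⇔ 0 0 a b)

i≢i+1 : ∀ i → i ≢ i +ℤ one
i≢i+1 i i≡i+1 = ℤP.i≢suc[i] (trans i≡i+1 (ℤP.+-comm i one))

q≢stepRight[q] : ∀ q → q ≢ stepRight q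
q≢stepRight[q] (x , y) e = i≢i+1 x (proj₁ (×-≡,≡←≡ e))

q≢stepUp[q] : ∀ q → q ≢ stepUp q
q≢stepUp[q] (x , y) e = i≢i+1 y (proj₂ (×-≡,≡←≡ e))

Neighbours : Point → Point → Set
Neighbours p q = q ≡ stepRight p ⊎ p ≡ stepRight q ⊎ q ≡ stepUp p ⊎ p ≡ stepUp q

Adj⇔Neighbours : ∀ p q → Adj p q ⇔ Neighbours p q
Adj⇔Neighbours (x , y) (x' , y') =
  mk⇔ (Sum.map ×-≡,≡→≡ (Sum.map ×-≡,≡→≡ (Sum.map ×-≡,≡→≡ ×-≡,≡→≡)))
      (Sum.map ×-≡,≡←≡ (Sum.map ×-≡,≡←≡ (Sum.map ×-≡,≡←≡ ×-≡,≡←≡)))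

Adj-sym : ∀ p q → Adj p q → Adj q p
Adj-sym p q a = from (Adj⇔Neighbours q p) (swap (to (Adj⇔Neighbours p q) a))
  where
  swap : Neighbours p q → Neighbours q p
  swap (inj₁ e) = inj₂ (inj₁ e)
  swap (inj₂ (inj₁ e)) = inj₁ e
  swap (inj₂ (inj₂ (inj₁ e))) = inj₂ (inj₂ (inj₂ e))
  swap (inj₂ (inj₂ (inj₂ e))) = inj₂ (inj₂ (inj₁ e))

adjB⇒Adj : ∀ a b → T (adjB a b) → Adj (pos a) (pos b)
adjB⇒Adj a b t = from (Adj⇔Neighbours (pos a) (pos b))
  (Sum.map (to (rightOfB⇔ a b)) (Sum.map (to (rightOfB⇔ b a)) (Sum.map (to (aboveB⇔ a b)) (to (aboveB⇔ b a))))
    (Sum.map₂ (λ t' → Sum.map₂ (T-∨⁻ (aboveB a b)) (T-∨⁻ (rightOfB b a) t')) (T-∨⁻ (rightOfB a b) t)))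

Adj⇒adjB : ∀ a b → Adj (pos a) (pos b) → T (adjB a b)
Adj⇒adjB a b adj with to (Adj⇔Neighbours (pos a) (pos b)) adj
... | inj₁ e = T-∨⁺ˡ _ (from (rightOfB⇔ a b) e)
... | inj₂ (inj₁ e) = T-∨⁺ʳ (rightOfB a b) (T-∨⁺ˡ _ (from (rightOfB⇔ b a) e))
... | inj₂ (inj₂ (inj₁ e)) = T-∨⁺ʳ (rightOfB a b) (T-∨⁺ʳ (rightOfB b a) (T-∨⁺ˡ _ (from (aboveB⇔ a b) e)))
... | inj₂ (inj₂ (inj₂ e)) = T-∨⁺ʳ (rightOfB a b) (T-∨⁺ʳ (rightOfB b a) (T-∨⁺ʳ (aboveB a b) (from (aboveB⇔ b a) e)))

record Compatible (a b : ℕ) : Set where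
  field
    distinct   : pos b ≢ pos a
    match-right : pos b ≡ stepRight (pos a) → right (tileN a) ≡ left (tileN b)
    match-left  : pos a ≡ stepRight (pos b) → right (tileN b) ≡ left (tileN a)
    match-up    : pos b ≡ stepUp (pos a) → up (tileN a) ≡ bottom (tileN b)
    match-down  : pos a ≡ stepUp (pos b) → up (tileN b) ≡ bottom (tileN a)

compatB⇒Compatible : ∀ a b → T (compatB a b) → Compatible a b
compatB⇒Compatible a b t
  with T-∧⁻ (not (sameB a b)) t
... | t₀ , t′ with T-∧⁻ (not (rightOfB a b) ∨ _) t′
... | t₁ , t″ with T-∧⁻ (not (rightOfB b a) ∨ _) t″
... | t₂ , t‴ with T-∧⁻ (not (aboveB a b) ∨ _) t‴
... | t₃ , t₄ = record
  { distinct = λ e → T-not⁻ t₀ (from (sameB⇔ a b) e)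
  ; match-right = λ e → ≡ᵇ⇒≡′ (T-⇒⁻ t₁ (from (rightOfB⇔ a b) e))
  ; match-left = λ e → ≡ᵇ⇒≡′ (T-⇒⁻ t₂ (from (rightOfB⇔ b a) e))
  ; match-up = λ e → ≡ᵇ⇒≡′ (T-⇒⁻ t₃ (from (aboveB⇔ a b) e))
  ; match-down = λ e → ≡ᵇ⇒≡′ (T-⇒⁻ t₄ (from (aboveB⇔ b a) e))
  }

Compatible⇒compatB : ∀ a b → Compatible a b → T (compatB a b)
Compatible⇒compatB a b c =
  T-∧⁺ (T-not⁺ (λ s → distinct (to (sameB⇔ a b) s)))
  (T-∧⁺ (T-⇒⁺ (λ r → ≡⇒≡ᵇ′ (match-right (to (rightOfB⇔ a b) r))))
  (T-∧⁺ (T-⇒⁺ (λ r → ≡⇒≡ᵇ′ (match-left (to (rightOfB⇔ b a) r))))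
  (T-∧⁺ (T-⇒⁺ (λ r → ≡⇒≡ᵇ′ (match-up (to (aboveB⇔ a b) r))))
        (T-⇒⁺ (λ r → ≡⇒≡ᵇ′ (match-down (to (aboveB⇔ b a) r)))))))
  where open Compatible c

path-start : ∀ {R p q} → PathIn R p q → R p
path-start (here r) = r
path-start (step r _ _) = r

path-++ : ∀ {R p q s} → PathIn R p q → PathIn R q s → PathIn R p s
path-++ (here _) b = b
path-++ (step r a rest) b = step r a (path-++ rest b)

path-reverse : ∀ {R p q} → PathIn R p q → PathIn R q p
path-reverse (here r) = here r
path-reverse {p = p} (step {p' = p'} r a rest) =
  path-++ (path-reverse rest) (step (path-start rest) (Adj-sym p p' a) (here r))

earlier : (ℕ → ℕ) → ℕ → List ℕ
earlier p i = reverse (applyUpTo p i) ++ []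

∈-earlier⁻ : ∀ p i {x} → x ∈ earlier p i → ∃ λ j → j < i × x ≡ p j
∈-earlier⁻ p i x∈ rewrite ++-identityʳ (reverse (applyUpTo p i)) = AnyP.applyUpTo⁻ p (AnyP.reverse⁻ x∈)

∈-earlier⁺ : ∀ p i j → j < i → p j ∈ earlier p i
∈-earlier⁺ p i j j<i rewrite ++-identityʳ (reverse (applyUpTo p i)) = AnyP.reverse⁺ (AnyP.applyUpTo⁺ p refl j<i)

checkL-∷ʳ : ∀ o r xs s → checkL o r (xs ++ [ s ]) ≡ checkL o r xs ∧ okB o (reverse xs ++ r) s
checkL-∷ʳ o r [] s = ∧-identityʳ (okB o r s)
checkL-∷ʳ o r (x ∷ xs) s rewrite checkL-∷ʳ o (x ∷ r) xs s
  | unfold-reverse x xs | ++-assoc (reverse xs) [ x ] r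
  = sym (∧-assoc (okB o r x) (checkL o (x ∷ r) xs) (okB o (reverse xs ++ x ∷ r) s))

checkL-++⁻ : ∀ o r xs ys → T (checkL o r (xs ++ ys)) → T (checkL o r xs)
checkL-++⁻ o r [] ys _ = tt
checkL-++⁻ o r (x ∷ xs) ys t with T-∧⁻ (okB o r x) t
... | tx , txs = T-∧⁺ tx (checkL-++⁻ o (x ∷ r) xs ys txs)

checkL-applyUpTo : ∀ o p i → T (checkL o [] (applyUpTo p (suc i))) ⇔ (T (checkL o [] (applyUpTo p i)) × T (okB o (earlier p i) (p i)))
checkL-applyUpTo o p i =
  mk⇔ (λ t → T-∧⁻ (checkL o [] (applyUpTo p i)) (subst T (checkL-∷ʳ o [] (applyUpTo p i) (p i)) (subst (λ l → T (checkL o [] l)) (sym (applyUpTo-∷ʳ p i)) t)))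
      (λ { (t , ok) → subst (λ l → T (checkL o [] l)) (applyUpTo-∷ʳ p i) (subst T (sym (checkL-∷ʳ o [] (applyUpTo p i) (p i))) (T-∧⁺ t ok)) })

record ValidAt (o p : ℕ → ℕ) (i : ℕ) : Set where
  field
    inTileSet  : o (tileN (p i)) ≡ 1
    connected  : 0 < i → ∃ λ j → j < i × Adj (pos (p i)) (pos (p j))
    compatible : ∀ j → j < i → Compatible (p i) (p j)

okB⇒ValidAt : ∀ o p i → T (okB o (earlier p i) (p i)) → ValidAt o p i
okB⇒ValidAt o p i t with T-∧⁻ (o (tileN (p i)) ≡ᵇ 1) t
... | t₀ , t′ with T-∧⁻ (null (earlier p i) ∨ any (adjB (p i)) (earlier p i)) t′
... | t₁ , t₂ = record
  { inTileSet = ≡ᵇ⇒≡′ t₀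
  ; connected = λ 0<i → adjacent i 0<i (T-∨⁻ (null (earlier p i)) t₁)
  ; compatible = λ j j<i → compatB⇒Compatible (p i) (p j) (All.lookup (all⁺ (compatB (p i)) _ t₂) (∈-earlier⁺ p i j j<i))
  }
  where
  adjacent : ∀ i → 0 < i → T (null (earlier p i)) ⊎ T (any (adjB (p i)) (earlier p i)) →
             ∃ λ j → j < i × Adj (pos (p i)) (pos (p j))
  adjacent i 0<i (inj₁ empty) with earlier p i | ∈-earlier⁺ p i 0 0<i
  ... | _ ∷ _ | _ = ⊥-elim empty
  adjacent i 0<i (inj₂ t) with find (any⁻ (adjB (p i)) _ t)
  ... | x , x∈ , adj with ∈-earlier⁻ p i x∈
  ... | j , j<i , refl = j , j<i , adjB⇒Adj (p i) (p j) adj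

ValidAt⇒okB : ∀ o p i → ValidAt o p i → T (okB o (earlier p i) (p i))
ValidAt⇒okB o p i v =
  T-∧⁺ (≡⇒≡ᵇ′ (ValidAt.inTileSet v)) (T-∧⁺ (nullOrAdjacent i v) (all⁻ (compatB (p i)) (All.tabulate compat)))
  where
  nullOrAdjacent : ∀ i → ValidAt o p i → T (null (earlier p i) ∨ any (adjB (p i)) (earlier p i))
  nullOrAdjacent zero _ = tt
  nullOrAdjacent (suc i) v with ValidAt.connected v (s≤s z≤n)
  ... | j , j<i , adj = T-∨⁺ʳ (null (earlier p (suc i)))
        (any⁺ (adjB (p (suc i))) (lose (∈-earlier⁺ p (suc i) j j<i) (Adj⇒adjB (p (suc i)) (p j) adj)))
  compat : ∀ {x} → x ∈ earlier p i → T (compatB (p i) x)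
  compat x∈ with ∈-earlier⁻ p i x∈
  ... | j , j<i , refl = Compatible⇒compatB (p i) (p j) (ValidAt.compatible v j j<i)

injection⇒¬Finite : ∀ (R : Region) (g : ℕ → Point) → (∀ i j → g i ≡ g j → i ≡ j) → (∀ i → R (g i)) → ¬ Finite R
injection⇒¬Finite R g g-injective g∈R (Ls , cover) with FinP.pigeonhole (n<1+n (length Ls)) index∘g
  where
  index∘g : Fin (suc (length Ls)) → Fin (length Ls)
  index∘g k = index (cover (g (toℕ k)) (g∈R (toℕ k)))
... | a , b , a<b , e = <⇒≢ a<b (g-injective (toℕ a) (toℕ b)
        (trans (AnyP.lookup-index (cover (g (toℕ a)) (g∈R (toℕ a))))
        (trans (cong (lookup Ls) e) (sym (AnyP.lookup-index (cover (g (toℕ b)) (g∈R (toℕ b))))))))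

-- A valid placement sequence is an infinite connected tiling

module PlacementTiling (lem : ∀ {ℓ} → ExcludedMiddle ℓ) (o p : ℕ → ℕ) (valid : ∀ i → ValidAt o p i) where

  pos-injective : ∀ i j → pos (p i) ≡ pos (p j) → i ≡ j
  pos-injective i j e with <-cmp i j
  ... | tri≈ _ i≡j _ = i≡j
  ... | tri< i<j _ _ = ⊥-elim (Compatible.distinct (ValidAt.compatible (valid j) i i<j) e)
  ... | tri> _ _ j<i = ⊥-elim (Compatible.distinct (ValidAt.compatible (valid i) j j<i) (sym e))

  Placed : Region
  Placed q = ∃ λ i → pos (p i) ≡ q

  tiling : Point → ℕ
  tiling q with lem {P = Placed q}
  ... | yes (i , _) = tileN (p i)
  ... | no _ = 0

  tiling-at : ∀ {q} → ((i , _) : Placed q) → tiling q ≡ tileN (p i)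
  tiling-at {q} (i , pi≡q) with lem {P = Placed q}
  ... | no ¬placed = ⊥-elim (¬placed (i , pi≡q))
  ... | yes (j , pj≡q) with pos-injective j i (trans pj≡q (sym pi≡q))
  ... | refl = refl

  match-right : ∀ i j → pos (p j) ≡ stepRight (pos (p i)) → right (tileN (p i)) ≡ left (tileN (p j))
  match-right i j e with <-cmp i j
  ... | tri≈ _ refl _ = ⊥-elim (q≢stepRight[q] _ e)
  ... | tri< i<j _ _ = Compatible.match-left (ValidAt.compatible (valid j) i i<j) e
  ... | tri> _ _ j<i = Compatible.match-right (ValidAt.compatible (valid i) j j<i) e

  match-up : ∀ i j → pos (p j) ≡ stepUp (pos (p i)) → up (tileN (p i)) ≡ bottom (tileN (p j))
  match-up i j e with <-cmp i j
  ... | tri≈ _ refl _ = ⊥-elim (q≢stepUp[q] _ e)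
  ... | tri< i<j _ _ = Compatible.match-down (ValidAt.compatible (valid j) i i<j) e
  ... | tri> _ _ j<i = Compatible.match-up (ValidAt.compatible (valid i) j j<i) e

  isTiling : IsTiling (λ t → o t ≡ 1) Placed tiling
  isTiling = (λ { q placed@(i , _) → trans (cong o (tiling-at placed)) (ValidAt.inTileSet (valid i)) }) ,
             horizontal , vertical
    where
    open ≡-Reasoning
    horizontal : ∀ x y → Placed (x , y) → Placed (x +ℤ one , y) → right (tiling (x , y)) ≡ left (tiling (x +ℤ one , y))
    horizontal x y pi@(i , pi≡) pj@(j , pj≡) = begin
      right (tiling (x , y))        ≡⟨ cong right (tiling-at pi) ⟩
      right (tileN (p i))           ≡⟨ match-right i j (trans pj≡ (cong stepRight (sym pi≡))) ⟩
      left (tileN (p j))            ≡⟨ cong left (sym (tiling-at pj)) ⟩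
      left (tiling (x +ℤ one , y))  ∎
    vertical : ∀ x y → Placed (x , y) → Placed (x , y +ℤ one) → up (tiling (x , y)) ≡ bottom (tiling (x , y +ℤ one))
    vertical x y pi@(i , pi≡) pj@(j , pj≡) = begin
      up (tiling (x , y))             ≡⟨ cong up (tiling-at pi) ⟩
      up (tileN (p i))                ≡⟨ match-up i j (trans pj≡ (cong stepUp (sym pi≡))) ⟩
      bottom (tileN (p j))            ≡⟨ cong bottom (sym (tiling-at pj)) ⟩
      bottom (tiling (x , y +ℤ one))  ∎

  pathToFirst : ∀ n i → i ≤ n → PathIn Placed (pos (p i)) (pos (p 0))
  pathToFirst n zero _ = here (0 , refl)
  pathToFirst (suc n) (suc i) (s≤s i≤n) with ValidAt.connected (valid (suc i)) (s≤s z≤n)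
  ... | j , s≤s j≤i , adj = step (suc i , refl) adj (pathToFirst n j (≤-trans j≤i i≤n))

  connected : Connected Placed
  connected q q' (i , refl) (j , refl) = path-++ (pathToFirst i i ≤-refl) (path-reverse (pathToFirst j j ≤-refl))

  infinite : ¬ Finite Placed
  infinite = injection⇒¬Finite Placed (λ i → pos (p i)) pos-injective (λ i → i , refl)

-- An infinite connected tiling can be enumerated as a valid placement sequence

toDiff : ℤ → ℕ × ℕ
toDiff (+ n) = n , 0
toDiff -[1+ n ] = 0 , suc n

diffCode : ℤ → ℕ
diffCode z = pair (proj₁ (toDiff z)) (proj₂ (toDiff z))

diffCode-⊖ : ∀ z → proj₁ (unpair (diffCode z)) ⊖ proj₂ (unpair (diffCode z)) ≡ z
diffCode-⊖ z rewrite fst-pair (proj₁ (toDiff z)) (proj₂ (toDiff z)) | snd-pair (proj₁ (toDiff z)) (proj₂ (toDiff z)) with z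
... | + n = ℤP.⊖-≥ z≤n
... | -[1+ n ] = refl

placement : (Point → ℕ) → Point → ℕ
placement F (x , y) = pair (pair (diffCode x) (diffCode y)) (F (x , y))

pos-placement : ∀ F q → pos (placement F q) ≡ q
pos-placement F (x , y) rewrite fst-pair (pair (diffCode x) (diffCode y)) (F (x , y))
  | fst-pair (diffCode x) (diffCode y) | snd-pair (diffCode x) (diffCode y) = cong₂ _,_ (diffCode-⊖ x) (diffCode-⊖ y)

tileN-placement : ∀ F q → tileN (placement F q) ≡ F q
tileN-placement F (x , y) = snd-pair (pair (diffCode x) (diffCode y)) (F (x , y))

module TilingPlacements (lem : ∀ {ℓ} → ExcludedMiddle ℓ) (o : ℕ → ℕ) (R : Region) (F : Point → ℕ)
  (conn : Connected R) (tiles : IsTiling (λ t → o t ≡ 1) R F) (inf : ¬ Finite R) where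

  Candidate : List Point → Point → Set
  Candidate Ps q = R q × ¬ (q ∈ Ps) × (Ps ≡ [] ⊎ Any (Adj q) Ps)

  exit : ∀ {Ps a b} → PathIn R a b → a ∈ Ps → ¬ b ∈ Ps → ∃ (Candidate Ps)
  exit (here _) a∈ b∉ = ⊥-elim (b∉ a∈)
  exit {Ps} (step {p = a} {p' = a'} ra adj rest) a∈ b∉ with lem {P = a' ∈ Ps}
  ... | yes a'∈ = exit rest a'∈ b∉
  ... | no a'∉ = a' , path-start rest , a'∉ , inj₂ (Any.map (λ { refl → Adj-sym a a' adj }) a∈)

  candidate-exists : ∀ Ps → (∀ {q} → q ∈ Ps → R q) → ∃ (Candidate Ps)
  candidate-exists Ps Ps⊆R with lem {P = ∃ λ r → R r × ¬ (r ∈ Ps)}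
  ... | no ¬outside = ⊥-elim (inf (Ps , λ q rq → covered q rq))
    where
    covered : ∀ q → R q → q ∈ Ps
    covered q rq with lem {P = q ∈ Ps}
    ... | yes q∈ = q∈
    ... | no q∉ = ⊥-elim (¬outside (q , rq , q∉))
  ... | yes (r , rr , r∉) with Ps
  ... | [] = r , rr , r∉ , inj₁ refl
  ... | l ∷ Ps′ = exit (conn l r (Ps⊆R (here refl)) rr) (here refl) r∉

  nextPoint : List Point → Point
  nextPoint Ps with lem {P = ∃ (Candidate Ps)}
  ... | yes (q , _) = q
  ... | no _ = (+ 0 , + 0)

  nextPoint-candidate : ∀ Ps → ∃ (Candidate Ps) → Candidate Ps (nextPoint Ps)
  nextPoint-candidate Ps ex with lem {P = ∃ (Candidate Ps)}
  ... | yes (q , c) = c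
  ... | no ¬ex = ⊥-elim (¬ex ex)

  visited : ℕ → List Point
  visited zero = []
  visited (suc n) = visited n ++ [ nextPoint (visited n) ]

  pt : ℕ → Point
  pt n = nextPoint (visited n)

  visited≡ : ∀ n → visited n ≡ applyUpTo pt n
  visited≡ zero = refl
  visited≡ (suc n) = trans (cong (_++ [ pt n ]) (visited≡ n)) (applyUpTo-∷ʳ pt n)

  mutual
    visited⊆R : ∀ n {q} → q ∈ visited n → R q
    visited⊆R (suc n) q∈ with AnyP.++⁻ (visited n) q∈
    ... | inj₁ q∈′ = visited⊆R n q∈′
    ... | inj₂ (here refl) = proj₁ (candidate n)

    candidate : ∀ n → Candidate (visited n) (pt n)
    candidate n = nextPoint-candidate (visited n) (candidate-exists (visited n) (visited⊆R n))

  pt∈R : ∀ n → R (pt n)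
  pt∈R n = proj₁ (candidate n)

  pt∈visited : ∀ j k → j < k → pt j ∈ visited k
  pt∈visited j k j<k = subst (pt j ∈_) (sym (visited≡ k)) (AnyP.applyUpTo⁺ pt refl j<k)

  p : ℕ → ℕ
  p n = placement F (pt n)

  tiles-right : ∀ q → R q → R (stepRight q) → right (F q) ≡ left (F (stepRight q))
  tiles-right (x , y) = proj₁ (proj₂ tiles) x y

  tiles-up : ∀ q → R q → R (stepUp q) → up (F q) ≡ bottom (F (stepUp q))
  tiles-up (x , y) = proj₂ (proj₂ tiles) x y

  match-right : ∀ {q q'} → R q → R q' → pos (placement F q') ≡ stepRight (pos (placement F q)) →
                right (tileN (placement F q)) ≡ left (tileN (placement F q'))
  match-right {q} {q'} rq rq' e = begin
    right (tileN (placement F q))   ≡⟨ cong right (tileN-placement F q) ⟩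
    right (F q)                     ≡⟨ tiles-right q rq (subst R q'≡ rq') ⟩
    left (F (stepRight q))          ≡⟨ cong (λ z → left (F z)) (sym q'≡) ⟩
    left (F q')                     ≡⟨ cong left (sym (tileN-placement F q')) ⟩
    left (tileN (placement F q'))   ∎
    where
    open ≡-Reasoning
    q'≡ : q' ≡ stepRight q
    q'≡ = trans (sym (pos-placement F q')) (trans e (cong stepRight (pos-placement F q)))

  match-up : ∀ {q q'} → R q → R q' → pos (placement F q') ≡ stepUp (pos (placement F q)) →
             up (tileN (placement F q)) ≡ bottom (tileN (placement F q'))
  match-up {q} {q'} rq rq' e = begin
    up (tileN (placement F q))       ≡⟨ cong up (tileN-placement F q) ⟩
    up (F q)                         ≡⟨ tiles-up q rq (subst R q'≡ rq') ⟩
    bottom (F (stepUp q))            ≡⟨ cong (λ z → bottom (F z)) (sym q'≡) ⟩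
    bottom (F q')                    ≡⟨ cong bottom (sym (tileN-placement F q')) ⟩
    bottom (tileN (placement F q'))  ∎
    where
    open ≡-Reasoning
    q'≡ : q' ≡ stepUp q
    q'≡ = trans (sym (pos-placement F q')) (trans e (cong stepUp (pos-placement F q)))

  earlier-neighbour : ∀ k → 0 < k → visited k ≡ [] ⊎ Any (Adj (pt k)) (visited k) →
                      ∃ λ j → j < k × Adj (pos (p k)) (pos (p j))
  earlier-neighbour k 0<k (inj₁ visited≡[]) with trans (sym (visited≡ k)) visited≡[] | 0<k
  ... | () | s≤s _
  earlier-neighbour k _ (inj₂ adj) with AnyP.applyUpTo⁻ pt (subst (Any (Adj (pt k))) (visited≡ k) adj)
  ... | j , j<k , a = j , j<k , subst₂ Adj (sym (pos-placement F (pt k))) (sym (pos-placement F (pt j))) a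

  valid : ∀ i → ValidAt o p i
  valid i = record
    { inTileSet = trans (cong o (tileN-placement F (pt i))) (proj₁ tiles (pt i) (pt∈R i))
    ; connected = connected i
    ; compatible = λ j j<i → record
      { distinct = λ e → proj₁ (proj₂ (candidate i))
          (subst (_∈ visited i) (trans (sym (pos-placement F (pt j))) (trans e (pos-placement F (pt i)))) (pt∈visited j i j<i))
      ; match-right = match-right (pt∈R i) (pt∈R j)
      ; match-left = match-right (pt∈R j) (pt∈R i)
      ; match-up = match-up (pt∈R i) (pt∈R j)
      ; match-down = match-up (pt∈R j) (pt∈R i)
      }
    }
    where
    connected : ∀ i → 0 < i → ∃ λ j → j < i × Adj (pos (p i)) (pos (p j))
    connected k 0<k = earlier-neighbour k 0<k (proj₂ (proj₂ (candidate k)))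

OnlyFiniteConnectedTilings : (ℕ → Set) → Set₁
OnlyFiniteConnectedTilings S = ∀ (R : Region) (f : Point → ℕ) → Connected R → IsTiling S R f → Finite R

WellFoundedTree : (List ℕ → Set) → Set
WellFoundedTree T′ = IsTree T′ × ¬ HasInfinitePath T′

id-onto : Onto (λ (n : ℕ) → n)
id-onto n = n , refl

encodeSeq-onto : Onto encodeSeq
encodeSeq-onto n = decodeSeq n , encodeSeq-decodeSeq n

OnlyFiniteConnectedTilings-resp : RespectsEquivalence OnlyFiniteConnectedTilings
OnlyFiniteConnectedTilings-resp S⇔S' finite R f conn (f∈S' , horizontal , vertical) =
  finite R f conn ((λ p p∈R → from (S⇔S' (f p)) (f∈S' p p∈R)) , horizontal , vertical)

WellFoundedTree-resp : RespectsEquivalence WellFoundedTree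
WellFoundedTree-resp T⇔T' (tree , noPath) =
  (λ σ τ στ∈T' → to (T⇔T' σ) (tree σ τ (from (T⇔T' (σ ++ τ)) στ∈T'))) ,
  (λ { (p , p∈T') → noPath (p , λ k → from (T⇔T' (applyUpTo p k)) (p∈T' k)) })

b2n≡1⇔T : ∀ p → b2n p ≡ 1 ⇔ T p
b2n≡1⇔T true = mk⇔ (λ _ → tt) (λ _ → refl)
b2n≡1⇔T false = mk⇔ (λ ()) (λ ())

-- The reduction SNT ≤m WELL

checkL-branch⇔ValidAt : ∀ o p → (∀ k → T (checkL o [] (applyUpTo p k))) ⇔ (∀ i → ValidAt o p i)
checkL-branch⇔ValidAt o p = mk⇔
  (λ checks i → okB⇒ValidAt o p i (proj₂ (to (checkL-applyUpTo o p i) (checks (suc i)))))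
  (λ valid → checks valid)
  where
  checks : (∀ i → ValidAt o p i) → ∀ k → T (checkL o [] (applyUpTo p k))
  checks valid zero = tt
  checks valid (suc k) = from (checkL-applyUpTo o p k) (checks valid k , ValidAt⇒okB o p k (valid k))

opaque
  placementChecker : Term
  placementChecker = Cₑ (compile checkD) (Pₑ Iₑ Zₑ)

  ev-placementChecker : ∀ o xs → ev o placementChecker (encodeSeq xs) ≡ b2n (checkL o [] xs)
  ev-placementChecker o xs = trans (compile-correct o [ encodeSeq xs ] checkD) (CheckD.eval-checkD o xs)

  placementChecker≤1 : ∀ o n → ev o placementChecker n ≤ 1
  placementChecker≤1 o n = subst (λ m → ev o placementChecker m ≤ 1) (encodeSeq-decodeSeq n)
    (subst (_≤ 1) (sym (ev-placementChecker o (decodeSeq n))) (b2n≤1 (checkL o [] (decodeSeq n))))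

module PlacementTree (lem : ∀ {ℓ} → ExcludedMiddle ℓ) (o : ℕ → ℕ) where

  InTree : List ℕ → Set
  InTree σ = ev o placementChecker (encodeSeq σ) ≡ 1

  InTree⇔checkL : ∀ σ → InTree σ ⇔ T (checkL o [] σ)
  InTree⇔checkL σ = subst (λ n → (n ≡ 1) ⇔ T (checkL o [] σ)) (sym (ev-placementChecker o σ)) (b2n≡1⇔T (checkL o [] σ))

  onlyFinite⇒wellFounded : OnlyFiniteConnectedTilings (λ t → o t ≡ 1) → WellFoundedTree InTree
  onlyFinite⇒wellFounded finite = tree , noPath
    where
    tree : IsTree InTree
    tree σ τ στ∈T = from (InTree⇔checkL σ) (checkL-++⁻ o [] σ τ (to (InTree⇔checkL (σ ++ τ)) στ∈T))
    noPath : ¬ HasInfinitePath InTree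
    noPath (p , p∈T) = infinite (finite Placed tiling connected isTiling)
      where
      open PlacementTiling lem o p (to (checkL-branch⇔ValidAt o p) (λ k → to (InTree⇔checkL (applyUpTo p k)) (p∈T k)))

  wellFounded⇒onlyFinite : WellFoundedTree InTree → OnlyFiniteConnectedTilings (λ t → o t ≡ 1)
  wellFounded⇒onlyFinite (_ , noPath) R F conn tiles with lem {P = Finite R}
  ... | yes finite = finite
  ... | no infinite = ⊥-elim (noPath (p , λ k → from (InTree⇔checkL (applyUpTo p k)) (from (checkL-branch⇔ValidAt o p) valid k)))
    where open TilingPlacements lem o R F conn tiles infinite

snt≤well : (∀ {ℓ} → ExcludedMiddle ℓ) → SNT ≤m WELL
snt≤well lem = UniformReduction.reduction lem (λ n → n) id-onto encodeSeq encodeSeq-onto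
  OnlyFiniteConnectedTilings WellFoundedTree OnlyFiniteConnectedTilings-resp WellFoundedTree-resp
  placementChecker (λ o _ → placementChecker≤1 o)
  (λ o _ → mk⇔ (PlacementTree.onlyFinite⇒wellFounded lem o) (PlacementTree.wellFounded⇒onlyFinite lem o))


-- The tile set of a tree

initL : List ℕ → List ℕ
initL xs = reverse (drop 1 (reverse xs))

allPrefixesB : (ℕ → ℕ) → List ℕ → List ℕ → Bool
allPrefixesB o ps [] = true
allPrefixesB o ps (h ∷ t) = (o (encodeSeq (ps ++ [ h ])) ≡ᵇ 1) ∧ allPrefixesB o (ps ++ [ h ]) t

prefixesB : (ℕ → ℕ) → List ℕ → Bool
prefixesB o xs = (o 0 ≡ᵇ 1) ∧ allPrefixesB o [] xs

normalB junkB tileB : (ℕ → ℕ) → ℕ → Bool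
normalB o t = (up t ≡ᵇ 0) ∧ (bottom t ≡ᵇ 1) ∧ not (right t ≡ᵇ 0) ∧
  (left t ≡ᵇ encodeSeq (initL (decodeSeq (right t)))) ∧ prefixesB o (decodeSeq (right t))
junkB o t = (left t ≡ᵇ up t) ∧ (up t ≡ᵇ right t) ∧ (right t ≡ᵇ bottom t) ∧
  (o (right t) ≡ᵇ 1) ∧ not (prefixesB o (decodeSeq (right t)))
tileB o t = normalB o t ∨ junkB o t

consD : Expr → Expr → Expr
consD h l = add (lit 1) (pr h l)

revD tailD initD : Expr → Expr
revD l = fold l (lit 0) (consD (var 0) (var 1))
tailD l = ifz l (lit 0) (snd (sub l (lit 1)))
initD l = revD (tailD (revD l))

-- The accumulator is pair (code of the reversed prefix read so far) flag.
prefixesBody : Expr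
prefixesBody = pr (consD (var 0) (fst (var 1)))
                  (toExpr ((snd (var 1) ≐ lit 1) ∧ᴮ (orc (revD (consD (var 0) (fst (var 1)))) ≐ lit 1)))

prefixesD : Expr → Expr
prefixesD l = snd (fold l (pr (lit 0) (toExpr (orc (lit 0) ≐ lit 1))) prefixesBody)

leftᴰ upᴰ rightᴰ bottomᴰ : Expr
leftᴰ = leftᴱ (var 0)
upᴰ = upᴱ (var 0)
rightᴰ = rightᴱ (var 0)
bottomᴰ = bottomᴱ (var 0)

tileᴮ : BExpr
tileᴮ = (upᴰ ≐ lit 0) ∧ᴮ (bottomᴰ ≐ lit 1) ∧ᴮ ¬ᴮ (rightᴰ ≐ lit 0) ∧ᴮ (leftᴰ ≐ initD rightᴰ) ∧ᴮ (prefixesD rightᴰ ≐ lit 1)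
   ∨ᴮ (leftᴰ ≐ upᴰ) ∧ᴮ (upᴰ ≐ rightᴰ) ∧ᴮ (rightᴰ ≐ bottomᴰ) ∧ᴮ (orc rightᴰ ≐ lit 1) ∧ᴮ ¬ᴮ (prefixesD rightᴰ ≐ lit 1)

foldl-cons : ∀ xs ys → foldl (λ acc h → suc (pair h acc)) (encodeSeq ys) xs ≡ encodeSeq (reverse xs ++ ys)
foldl-cons [] ys = refl
foldl-cons (x ∷ xs) ys rewrite foldl-cons xs (x ∷ ys) | unfold-reverse x xs | ++-assoc (reverse xs) [ x ] ys = refl

module TileD (o : ℕ → ℕ) where

  eval-revD : ∀ ρ a xs → eval o ρ a ≡ encodeSeq xs → eval o ρ (revD a) ≡ encodeSeq (reverse xs)
  eval-revD ρ a xs a≡xs rewrite a≡xs | foldCode-encodeSeq (λ h acc → suc (pair h acc)) xs 0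
    | foldl-cons xs [] | ++-identityʳ (reverse xs) = refl

  eval-tailD : ∀ ρ a xs → eval o ρ a ≡ encodeSeq xs → eval o ρ (tailD a) ≡ encodeSeq (drop 1 xs)
  eval-tailD ρ a [] a≡xs rewrite a≡xs = refl
  eval-tailD ρ a (h ∷ t) a≡xs rewrite a≡xs = snd-pair h (encodeSeq t)

  eval-initD : ∀ ρ a xs → eval o ρ a ≡ encodeSeq xs → eval o ρ (initD a) ≡ encodeSeq (initL xs)
  eval-initD ρ a xs a≡xs =
    eval-revD ρ (tailD (revD a)) (drop 1 (reverse xs)) (eval-tailD ρ (revD a) (reverse xs) (eval-revD ρ a xs a≡xs))

  prefixes-step : ∀ ρ ps h fl → eval o (h ∷ pair (encodeSeq (reverse ps)) (b2n fl) ∷ ρ) prefixesBody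
      ≡ pair (encodeSeq (reverse (ps ++ [ h ]))) (b2n (fl ∧ (o (encodeSeq (ps ++ [ h ])) ≡ᵇ 1)))
  prefixes-step ρ ps h fl = cong₂ pair code≡
    (trans (eval-toExpr o env ((snd (var 1) ≐ lit 1) ∧ᴮ (orc (revD (consD (var 0) (fst (var 1)))) ≐ lit 1)))
      (cong b2n (cong₂ _∧_ (snd-pair-≡ᵇ1 (encodeSeq (reverse ps)) fl)
        (cong (λ z → o z ≡ᵇ 1) (trans (eval-revD env (consD (var 0) (fst (var 1))) (reverse (ps ++ [ h ])) code≡)
                                       (cong encodeSeq (reverse-involutive (ps ++ [ h ]))))))))
    where
    env : List ℕ
    env = h ∷ pair (encodeSeq (reverse ps)) (b2n fl) ∷ ρ
    code≡ : suc (pair h (proj₁ (unpair (pair (encodeSeq (reverse ps)) (b2n fl))))) ≡ encodeSeq (reverse (ps ++ [ h ]))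
    code≡ rewrite fst-pair (encodeSeq (reverse ps)) (b2n fl) | reverse-++ ps [ h ] = refl

  prefixes-fold : ∀ ρ xs ps fl →
    foldl (λ acc h → eval o (h ∷ acc ∷ ρ) prefixesBody) (pair (encodeSeq (reverse ps)) (b2n fl)) xs
      ≡ pair (encodeSeq (reverse (ps ++ xs))) (b2n (fl ∧ allPrefixesB o ps xs))
  prefixes-fold ρ [] ps fl rewrite ++-identityʳ ps | ∧-identityʳ fl = refl
  prefixes-fold ρ (h ∷ xs) ps fl
    rewrite prefixes-step ρ ps h fl | prefixes-fold ρ xs (ps ++ [ h ]) (fl ∧ (o (encodeSeq (ps ++ [ h ])) ≡ᵇ 1))
          | ++-assoc ps [ h ] xs | ∧-assoc fl (o (encodeSeq (ps ++ [ h ])) ≡ᵇ 1) (allPrefixesB o (ps ++ [ h ]) xs) = refl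

  eval-prefixesD : ∀ ρ a xs → eval o ρ a ≡ encodeSeq xs → eval o ρ (prefixesD a) ≡ b2n (prefixesB o xs)
  eval-prefixesD ρ a xs a≡xs rewrite a≡xs
    | foldCode-encodeSeq (λ h acc → eval o (h ∷ acc ∷ ρ) prefixesBody) xs (pair 0 (b2n (o 0 ≡ᵇ 1)))
    | prefixes-fold ρ xs [] (o 0 ≡ᵇ 1) = snd-pair (encodeSeq (reverse xs)) (b2n ((o 0 ≡ᵇ 1) ∧ allPrefixesB o [] xs))

  evalB-tileᴮ : ∀ t → evalB o [ t ] tileᴮ ≡ tileB o t
  evalB-tileᴮ t
    rewrite eval-initD [ t ] rightᴰ (decodeSeq (right t)) (sym (encodeSeq-decodeSeq (right t)))
          | eval-prefixesD [ t ] rightᴰ (decodeSeq (right t)) (sym (encodeSeq-decodeSeq (right t)))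
          | b2n-≡ᵇ1 (prefixesB o (decodeSeq (right t))) = refl

  eval-tileᴮ : ∀ t → eval o [ t ] (toExpr tileᴮ) ≡ b2n (tileB o t)
  eval-tileᴮ t = trans (eval-toExpr o [ t ] tileᴮ) (cong b2n (evalB-tileᴮ t))


-- The reduction WELL ≤m SNT

initL-∷ʳ : ∀ xs x → initL (xs ++ [ x ]) ≡ xs
initL-∷ʳ xs x rewrite reverse-++ xs [ x ] = reverse-involutive xs

≢[]⇒initL-∷ʳ : ∀ xs → xs ≢ [] → ∃ λ m → xs ≡ initL xs ++ [ m ]
≢[]⇒initL-∷ʳ xs xs≢[] with reverse xs in eq
... | [] = ⊥-elim (xs≢[] (trans (sym (reverse-involutive xs)) (cong reverse eq)))
... | h ∷ t = h , trans (sym (reverse-involutive xs)) (trans (cong reverse eq) (unfold-reverse h t))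

applyUpTo-++⁻ : ∀ (f : ℕ → ℕ) k ys zs → applyUpTo f k ≡ ys ++ zs → ys ≡ applyUpTo f (length ys)
applyUpTo-++⁻ f k [] zs e = refl
applyUpTo-++⁻ f (suc k) (y ∷ ys) zs e with ∷-injective e
... | fy≡y , rest = cong₂ _∷_ (sym fy≡y) (applyUpTo-++⁻ (λ n → f (suc n)) k ys zs rest)

lookupOr0-++ : ∀ xs z zs → lookupOr0 (xs ++ z ∷ zs) (length xs) ≡ z
lookupOr0-++ [] z zs = refl
lookupOr0-++ (x ∷ xs) z zs = lookupOr0-++ xs z zs

tile : ℕ → ℕ → ℕ → ℕ → ℕ
tile l u r b = pair l (pair u (pair r b))

left-tile : ∀ l u r b → left (tile l u r b) ≡ l
left-tile l u r b = fst-pair l _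

up-tile : ∀ l u r b → up (tile l u r b) ≡ u
up-tile l u r b rewrite snd-pair l (pair u (pair r b)) = fst-pair u _

right-tile : ∀ l u r b → right (tile l u r b) ≡ r
right-tile l u r b rewrite snd-pair l (pair u (pair r b)) | snd-pair u (pair r b) = fst-pair r b

bottom-tile : ∀ l u r b → bottom (tile l u r b) ≡ b
bottom-tile l u r b rewrite snd-pair l (pair u (pair r b)) | snd-pair u (pair r b) = snd-pair r b

row⇒¬OnlyFiniteConnectedTilings : ∀ (S : ℕ → Set) (G : ℕ → ℕ) → (∀ n → S (G n)) → (∀ n → right (G n) ≡ left (G (suc n))) →
                                   ¬ OnlyFiniteConnectedTilings S
row⇒¬OnlyFiniteConnectedTilings S G G∈S G-match finite =
  injection⇒¬Finite Ray ray (λ i j e → ℤP.+-injective (cong proj₁ e)) (λ n → n , refl)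
    (finite Ray F connected (F∈S , horizontal , vertical))
  where
  ray : ℕ → Point
  ray n = (+ n , + 0)
  Ray : Region
  Ray q = ∃ λ n → q ≡ ray n
  F : Point → ℕ
  F (+ n , _) = G n
  F (-[1+ n ] , _) = 0
  F∈S : ∀ q → Ray q → S (F q)
  F∈S q (n , refl) = G∈S n
  horizontal : ∀ x y → Ray (x , y) → Ray (x +ℤ one , y) → right (F (x , y)) ≡ left (F (x +ℤ one , y))
  horizontal .(+ n) .(+ 0) (n , refl) _ = trans (G-match n) (cong (λ k → left (G k)) (+-comm 1 n))
  vertical : ∀ x y → Ray (x , y) → Ray (x , y +ℤ one) → up (F (x , y)) ≡ bottom (F (x , y +ℤ one))
  vertical .(+ n) .(+ 0) (n , refl) (m , ())
  toOrigin : ∀ n → PathIn Ray (ray n) (ray 0)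
  toOrigin zero = here (0 , refl)
  toOrigin (suc n) = step (suc n , refl) (inj₂ (inj₁ (cong +_ (sym (+-comm n 1)) , refl))) (toOrigin n)
  connected : Connected Ray
  connected q q' (n , refl) (m , refl) = path-++ (toOrigin n) (path-reverse (toOrigin m))

module TreeTiles (o : ℕ → ℕ) where

  InTree : List ℕ → Set
  InTree σ = o (encodeSeq σ) ≡ 1

  AllPrefixesIn : List ℕ → Set
  AllPrefixesIn xs = ∀ ys zs → xs ≡ ys ++ zs → InTree ys

  allPrefixesB⇒ : ∀ ps xs → T (allPrefixesB o ps xs) → ∀ y ys zs → xs ≡ (y ∷ ys) ++ zs → InTree (ps ++ y ∷ ys)
  allPrefixesB⇒ ps (h ∷ t) tb y [] zs refl = ≡ᵇ⇒≡′ (proj₁ (T-∧⁻ (o (encodeSeq (ps ++ [ h ])) ≡ᵇ 1) tb))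
  allPrefixesB⇒ ps (h ∷ t) tb y (y' ∷ ys) zs refl = subst InTree (++-assoc ps [ h ] (y' ∷ ys))
    (allPrefixesB⇒ (ps ++ [ h ]) t (proj₂ (T-∧⁻ (o (encodeSeq (ps ++ [ h ])) ≡ᵇ 1) tb)) y' ys zs refl)

  allPrefixesB⇐ : ∀ ps xs → (∀ y ys zs → xs ≡ (y ∷ ys) ++ zs → InTree (ps ++ y ∷ ys)) → T (allPrefixesB o ps xs)
  allPrefixesB⇐ ps [] _ = tt
  allPrefixesB⇐ ps (h ∷ t) prefixes = T-∧⁺ (≡⇒≡ᵇ′ (prefixes h [] t refl)) (allPrefixesB⇐ (ps ++ [ h ]) t
    λ y ys zs e → subst InTree (sym (++-assoc ps [ h ] (y ∷ ys))) (prefixes h (y ∷ ys) zs (cong (h ∷_) e)))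

  prefixesB⇔ : ∀ xs → T (prefixesB o xs) ⇔ AllPrefixesIn xs
  prefixesB⇔ xs = mk⇔ forth back
    where
    forth : T (prefixesB o xs) → AllPrefixesIn xs
    forth tb [] zs e = ≡ᵇ⇒≡′ (proj₁ (T-∧⁻ (o 0 ≡ᵇ 1) tb))
    forth tb (y ∷ ys) zs e = allPrefixesB⇒ [] xs (proj₂ (T-∧⁻ (o 0 ≡ᵇ 1) tb)) y ys zs e
    back : AllPrefixesIn xs → T (prefixesB o xs)
    back prefixes = T-∧⁺ (≡⇒≡ᵇ′ (prefixes [] xs refl)) (allPrefixesB⇐ [] xs λ y ys zs e → prefixes (y ∷ ys) zs e)

  record Normal (t : ℕ) : Set where
    field
      up≡0 : up t ≡ 0
      bottom≡1 : bottom t ≡ 1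
      right≢[] : decodeSeq (right t) ≢ []
      left≡init : left t ≡ encodeSeq (initL (decodeSeq (right t)))
      prefixes : AllPrefixesIn (decodeSeq (right t))

  record Junk (t : ℕ) : Set where
    field
      left≡up : left t ≡ up t
      up≡right : up t ≡ right t
      right≡bottom : right t ≡ bottom t
      inTree : InTree (decodeSeq (right t))
      ¬prefixes : ¬ AllPrefixesIn (decodeSeq (right t))

  tileB⇒Normal⊎Junk : ∀ t → T (tileB o t) → Normal t ⊎ Junk t
  tileB⇒Normal⊎Junk t tb with T-∨⁻ (normalB o t) tb
  ... | inj₁ n =
    let n₁ , n′ = T-∧⁻ (up t ≡ᵇ 0) n
        n₂ , n″ = T-∧⁻ (bottom t ≡ᵇ 1) n′
        n₃ , n‴ = T-∧⁻ (not (right t ≡ᵇ 0)) n″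
        n₄ , n₅ = T-∧⁻ (left t ≡ᵇ encodeSeq (initL (decodeSeq (right t)))) n‴
    in inj₁ (record
      { up≡0 = ≡ᵇ⇒≡′ n₁ ; bottom≡1 = ≡ᵇ⇒≡′ n₂
      ; right≢[] = λ e → T-not⁻ n₃ (≡⇒≡ᵇ′ (trans (sym (encodeSeq-decodeSeq (right t))) (cong encodeSeq e)))
      ; left≡init = ≡ᵇ⇒≡′ n₄ ; prefixes = to (prefixesB⇔ _) n₅ })
  ... | inj₂ j =
    let j₁ , j′ = T-∧⁻ (left t ≡ᵇ up t) j
        j₂ , j″ = T-∧⁻ (up t ≡ᵇ right t) j′
        j₃ , j‴ = T-∧⁻ (right t ≡ᵇ bottom t) j″
        j₄ , j₅ = T-∧⁻ (o (right t) ≡ᵇ 1) j‴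
    in inj₂ (record
      { left≡up = ≡ᵇ⇒≡′ j₁ ; up≡right = ≡ᵇ⇒≡′ j₂ ; right≡bottom = ≡ᵇ⇒≡′ j₃
      ; inTree = trans (cong o (encodeSeq-decodeSeq (right t))) (≡ᵇ⇒≡′ j₄)
      ; ¬prefixes = λ prefixes → T-not⁻ j₅ (from (prefixesB⇔ _) prefixes) })

  Normal⇒tileB : ∀ t → Normal t → T (tileB o t)
  Normal⇒tileB t n = T-∨⁺ˡ _ (T-∧⁺ (≡⇒≡ᵇ′ up≡0) (T-∧⁺ (≡⇒≡ᵇ′ bottom≡1)
    (T-∧⁺ (T-not⁺ (λ r≡0 → right≢[] (cong decodeSeq (≡ᵇ⇒≡′ r≡0))))
    (T-∧⁺ (≡⇒≡ᵇ′ left≡init) (from (prefixesB⇔ _) prefixes)))))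
    where open Normal n

  Junk⇒tileB : ∀ t → Junk t → T (tileB o t)
  Junk⇒tileB t j = T-∨⁺ʳ (normalB o t) (T-∧⁺ (≡⇒≡ᵇ′ left≡up) (T-∧⁺ (≡⇒≡ᵇ′ up≡right) (T-∧⁺ (≡⇒≡ᵇ′ right≡bottom)
    (T-∧⁺ (≡⇒≡ᵇ′ (trans (cong o (sym (encodeSeq-decodeSeq (right t)))) inTree))
          (T-not⁺ (λ tb → ¬prefixes (to (prefixesB⇔ _) tb)))))))
    where open Junk j

  onlyFinite⇒tree : ExcludedMiddle lzero → OnlyFiniteConnectedTilings (λ t → T (tileB o t)) → IsTree InTree
  onlyFinite⇒tree lem finite σ τ στ∈T with lem {P = InTree σ}
  ... | yes σ∈T = σ∈T
  ... | no σ∉T = ⊥-elim (row⇒¬OnlyFiniteConnectedTilings (λ t → T (tileB o t)) (λ _ → junkTile) (λ _ → Junk⇒tileB junkTile junk)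
                   (λ _ → trans (right-tile c c c c) (sym (left-tile c c c c))) finite)
    where
    c junkTile : ℕ
    c = encodeSeq (σ ++ τ)
    junkTile = tile c c c c
    decode-right : decodeSeq (right junkTile) ≡ σ ++ τ
    decode-right = trans (cong decodeSeq (right-tile c c c c)) (decodeSeq-encodeSeq (σ ++ τ))
    junk : Junk junkTile
    junk = record
      { left≡up = trans (left-tile c c c c) (sym (up-tile c c c c))
      ; up≡right = trans (up-tile c c c c) (sym (right-tile c c c c))
      ; right≡bottom = trans (right-tile c c c c) (sym (bottom-tile c c c c))
      ; inTree = subst InTree (sym decode-right) στ∈T
      ; ¬prefixes = λ prefixes → σ∉T (prefixes σ τ decode-right) }

  onlyFinite⇒noPath : OnlyFiniteConnectedTilings (λ t → T (tileB o t)) → ¬ HasInfinitePath InTree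
  onlyFinite⇒noPath finite (p , p∈T) =
    row⇒¬OnlyFiniteConnectedTilings (λ t → T (tileB o t)) G (λ n → Normal⇒tileB (G n) (normal n)) match finite
    where
    A : ℕ → List ℕ
    A = applyUpTo p
    c : ℕ → ℕ
    c n = encodeSeq (A n)
    G : ℕ → ℕ
    G n = tile (c n) 0 (c (suc n)) 1
    match : ∀ n → right (G n) ≡ left (G (suc n))
    match n = trans (right-tile (c n) 0 (c (suc n)) 1) (sym (left-tile (c (suc n)) 0 (c (suc (suc n))) 1))
    decode-right : ∀ n → decodeSeq (right (G n)) ≡ A (suc n)
    decode-right n = trans (cong decodeSeq (right-tile (c n) 0 (c (suc n)) 1)) (decodeSeq-encodeSeq (A (suc n)))
    normal : ∀ n → Normal (G n)
    normal n = record
      { up≡0 = up-tile (c n) 0 (c (suc n)) 1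
      ; bottom≡1 = bottom-tile (c n) 0 (c (suc n)) 1
      ; right≢[] = λ e → A[1+n]≢[] (trans (sym (decode-right n)) e)
      ; left≡init = trans (left-tile (c n) 0 (c (suc n)) 1)
          (cong encodeSeq (sym (trans (cong initL (trans (decode-right n) (sym (applyUpTo-∷ʳ p n)))) (initL-∷ʳ (A n) (p n)))))
      ; prefixes = λ ys zs e →
          subst InTree (sym (applyUpTo-++⁻ p (suc n) ys zs (trans (sym (decode-right n)) e))) (p∈T (length ys)) }
      where
      A[1+n]≢[] : A (suc n) ≢ []
      A[1+n]≢[] ()

i≤i+1 : ∀ i → i ≤ℤ i +ℤ one
i≤i+1 i = subst (i ≤ℤ_) (ℤP.+-comm one i) (ℤP.i≤suc[i] i)

i<j⇒i+1≤j : ∀ {i j} → i <ℤ j → i +ℤ one ≤ℤ j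
i<j⇒i+1≤j {i} {j} i<j = subst (_≤ℤ j) (ℤP.+-comm one i) (ℤP.i<j⇒suc[i]≤j i<j)

i≤i+n : ∀ i n → i ≤ℤ i +ℤ + n
i≤i+n i n = subst (i ≤ℤ_) (ℤP.+-comm (+ n) i) (ℤP.i≤j+i i (+ n))

i+[1+n] : ∀ x i → x +ℤ + suc i ≡ (x +ℤ + i) +ℤ one
i+[1+n] x i = trans (cong (λ k → x +ℤ + k) (+-comm 1 i)) (sym (ℤP.+-assoc x (+ i) one))

module TreeTilingsFinite (lem : ∀ {ℓ} → ExcludedMiddle ℓ) (o : ℕ → ℕ)
  (tree : IsTree (TreeTiles.InTree o)) (noPath : ¬ HasInfinitePath (TreeTiles.InTree o))
  (R : Region) (F : Point → ℕ) (conn : Connected R) (tiles : IsTiling (λ t → T (tileB o t)) R F) (inf : ¬ Finite R) where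
  open TreeTiles o

  normal : ∀ q → R q → Normal (F q)
  normal q rq with tileB⇒Normal⊎Junk (F q) (proj₁ tiles q rq)
  ... | inj₁ n = n
  ... | inj₂ j = ⊥-elim (Junk.¬prefixes j λ ys zs e → tree ys zs (subst InTree e (Junk.inTree j)))

  no-vertical : ∀ x y → R (x , y) → R (x , y +ℤ one) → ⊥
  no-vertical x y r r′ with trans (sym (Normal.up≡0 (normal _ r))) (trans (proj₂ (proj₂ tiles) x y r r′) (Normal.bottom≡1 (normal _ r′)))
  ... | ()

  seqAt : Point → List ℕ
  seqAt q = decodeSeq (right (F q))

  lengthAt : Point → ℕ
  lengthAt q = length (seqAt q)

  seqAt-stepRight : ∀ x y → R (x , y) → R (x +ℤ one , y) → ∃ λ m → seqAt (x +ℤ one , y) ≡ seqAt (x , y) ++ [ m ]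
  seqAt-stepRight x y r r′ with ≢[]⇒initL-∷ʳ (seqAt (x +ℤ one , y)) (Normal.right≢[] (normal _ r′))
  ... | m , e = m , trans e (cong (_++ [ m ]) (sym seq≡init))
    where
    seq≡init : seqAt (x , y) ≡ initL (seqAt (x +ℤ one , y))
    seq≡init = trans (cong decodeSeq (trans (proj₁ (proj₂ tiles) x y r r′) (Normal.left≡init (normal _ r′))))
                     (decodeSeq-encodeSeq _)

  potential : Point → ℤ
  potential q = + lengthAt q - proj₁ q

  potential-stepRight : ∀ x y → R (x , y) → R (x +ℤ one , y) → potential (x +ℤ one , y) ≡ potential (x , y)
  potential-stepRight x y r r′ with seqAt-stepRight x y r r′
  ... | m , e = trans (cong (λ k → + k - (x +ℤ one)) (trans (cong length e) (length-++ (seqAt (x , y)))))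
                      (shift-cancel (+ lengthAt (x , y)) x)
    where
    open +-*-Solver
    shift-cancel : ∀ (a x : ℤ) → (a +ℤ one) - (x +ℤ one) ≡ a - x
    shift-cancel = solve 2 (λ a x → (a :+ con one) :- (x :+ con one) := a :- x) refl

  Adj-invariant : ∀ a a' → R a → R a' → Adj a a' → proj₂ a' ≡ proj₂ a × potential a' ≡ potential a
  Adj-invariant (x , y) (x' , y') ra ra' (inj₁ (refl , refl)) = refl , potential-stepRight x y ra ra'
  Adj-invariant (x , y) (x' , y') ra ra' (inj₂ (inj₁ (refl , refl))) = refl , sym (potential-stepRight x' y' ra' ra)
  Adj-invariant (x , y) (x' , y') ra ra' (inj₂ (inj₂ (inj₁ (refl , refl)))) = ⊥-elim (no-vertical x y ra ra')
  Adj-invariant (x , y) (x' , y') ra ra' (inj₂ (inj₂ (inj₂ (refl , refl)))) = ⊥-elim (no-vertical x' y' ra' ra)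

  path-invariant : ∀ {a b} → PathIn R a b → proj₂ b ≡ proj₂ a × potential b ≡ potential a
  path-invariant (here _) = refl , refl
  path-invariant (step {p = a} {p' = a'} ra adj rest)
    with Adj-invariant a a' ra (path-start rest) adj | path-invariant rest
  ... | y≡ , pot≡ | y≡′ , pot≡′ = trans y≡′ y≡ , trans pot≡′ pot≡

  origin : Point
  origin with lem {P = ∃ R}
  ... | yes (q , _) = q
  ... | no _ = (+ 0 , + 0)

  origin∈R : R origin
  origin∈R with lem {P = ∃ R}
  ... | yes (q , rq) = rq
  ... | no ¬∃R = ⊥-elim (inf ([] , λ q rq → ⊥-elim (¬∃R (q , rq))))

  x₀ y₀ potential₀ : ℤ
  x₀ = proj₁ origin
  y₀ = proj₂ origin
  potential₀ = potential origin

  invariant : ∀ q → R q → proj₂ q ≡ y₀ × potential q ≡ potential₀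
  invariant q rq = path-invariant (conn origin q origin∈R rq)

  x≡length-potential₀ : ∀ q → R q → proj₁ q ≡ + lengthAt q - potential₀
  x≡length-potential₀ q rq = trans (solve-x (+ lengthAt q) (proj₁ q)) (cong (λ z → + lengthAt q - z) (proj₂ (invariant q rq)))
    where
    open +-*-Solver
    solve-x : ∀ (a x : ℤ) → x ≡ a - (a - x)
    solve-x = solve 2 (λ a x → x := a :- (a :- x)) refl

  -- Points of R are determined by their sequence length, so R cannot have bounded lengths.
  long-point : ∀ M → ∃ λ q → R q × M ≤ lengthAt q
  long-point M with lem {P = ∃ λ q → R q × M ≤ lengthAt q}
  ... | yes long = long
  ... | no ¬long = ⊥-elim (inf (applyUpTo g M , cover))
    where
    g : ℕ → Point
    g k = (+ k - potential₀ , y₀)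
    cover : ∀ q → R q → Any (q ≡_) (applyUpTo g M)
    cover q rq with lem {P = M ≤ lengthAt q}
    ... | yes M≤ = ⊥-elim (¬long (q , rq , M≤))
    ... | no M≰ = AnyP.applyUpTo⁺ g (×-≡,≡→≡ (x≡length-potential₀ q rq , proj₁ (invariant q rq))) (≰⇒> M≰)

  Adj-x≤x+1 : ∀ a a' → Adj a a' → proj₁ a' ≤ℤ proj₁ a +ℤ one
  Adj-x≤x+1 (x , y) (x' , y') (inj₁ (refl , _)) = ℤP.≤-refl
  Adj-x≤x+1 (x , y) (x' , y') (inj₂ (inj₁ (refl , _))) = ℤP.≤-trans (i≤i+1 x') (i≤i+1 (x' +ℤ one))
  Adj-x≤x+1 (x , y) (x' , y') (inj₂ (inj₂ (inj₁ (refl , _)))) = i≤i+1 x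
  Adj-x≤x+1 (x , y) (x' , y') (inj₂ (inj₂ (inj₂ (refl , _)))) = i≤i+1 x

  on-row : ∀ a → R a → ∀ x → x ≡ proj₁ a → R (x , y₀)
  on-row a ra x refl = subst (λ y → R (proj₁ a , y)) (proj₁ (invariant a ra)) ra

  path-passes : ∀ {a b} → PathIn R a b → ∀ x → proj₁ a ≤ℤ x → x ≤ℤ proj₁ b → R (x , y₀)
  path-passes {a} (here ra) x a≤x x≤b = on-row a ra x (ℤP.≤-antisym x≤b a≤x)
  path-passes {a} (step {p' = a'} ra adj rest) x a≤x x≤b with x ℤP.≟ proj₁ a
  ... | yes x≡a = on-row a ra x x≡a
  ... | no x≢a = path-passes rest x (ℤP.≤-trans (Adj-x≤x+1 a a' adj) (i<j⇒i+1≤j (ℤP.≤∧≢⇒< a≤x (λ e → x≢a (sym e))))) x≤b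

  ray∈R : ∀ i → R (x₀ +ℤ + i , y₀)
  ray∈R i with long-point (lengthAt origin + i)
  ... | q , rq , long = path-passes (conn origin q origin∈R rq) (x₀ +ℤ + i) (i≤i+n x₀ i) bound
    where
    open +-*-Solver
    reassoc : ∀ (a i p : ℤ) → (a - p) +ℤ i ≡ (a +ℤ i) - p
    reassoc = solve 3 (λ a i p → (a :- p) :+ i := (a :+ i) :- p) refl
    bound : x₀ +ℤ + i ≤ℤ proj₁ q
    bound = subst₂ _≤ℤ_
      (trans (sym (reassoc (+ lengthAt origin) (+ i) potential₀)) (cong (_+ℤ + i) (sym (x≡length-potential₀ origin origin∈R))))
      (sym (x≡length-potential₀ q rq))
      (ℤP.+-monoˡ-≤ (- potential₀) (+≤+ long))

  raySeq : ℕ → List ℕ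
  raySeq i = seqAt (x₀ +ℤ + i , y₀)

  raySeq-suc : ∀ i → ∃ λ m → raySeq (suc i) ≡ raySeq i ++ [ m ]
  raySeq-suc i = subst (λ x → ∃ λ m → seqAt (x , y₀) ≡ raySeq i ++ [ m ]) (sym (i+[1+n] x₀ i))
    (seqAt-stepRight (x₀ +ℤ + i) y₀ (ray∈R i) (subst (λ x → R (x , y₀)) (i+[1+n] x₀ i) (ray∈R (suc i))))

  length-raySeq : ∀ i → length (raySeq i) ≡ length (raySeq 0) + i
  length-raySeq zero = sym (+-identityʳ _)
  length-raySeq (suc i) = begin
    length (raySeq (suc i))                  ≡⟨ cong length (proj₂ (raySeq-suc i)) ⟩
    length (raySeq i ++ [ _ ])               ≡⟨ length-++ (raySeq i) ⟩
    length (raySeq i) + 1                    ≡⟨ cong (_+ 1) (length-raySeq i) ⟩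
    length (raySeq 0) + i + 1                ≡⟨ +-assoc (length (raySeq 0)) i 1 ⟩
    length (raySeq 0) + (i + 1)              ≡⟨ cong (_+_ (length (raySeq 0))) (+-comm i 1) ⟩
    length (raySeq 0) + suc i                ∎
    where open ≡-Reasoning

  -- The j-th entry of the branch is read off the j-th point of the ray, where it is already present.
  branch : ℕ → ℕ
  branch j = lookupOr0 (raySeq j) j

  1≤length-raySeq₀ : 1 ≤ length (raySeq 0)
  1≤length-raySeq₀ = ≢[]⇒1≤length (raySeq 0) (Normal.right≢[] (normal _ (ray∈R 0)))
    where
    ≢[]⇒1≤length : ∀ (xs : List ℕ) → xs ≢ [] → 1 ≤ length xs
    ≢[]⇒1≤length [] xs≢[] = ⊥-elim (xs≢[] refl)
    ≢[]⇒1≤length (_ ∷ _) _ = s≤s z≤n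

  branch-prefix : ∀ k → ∃ λ zs → raySeq k ≡ applyUpTo branch k ++ zs
  branch-prefix zero = raySeq 0 , refl
  branch-prefix (suc k) = extend (proj₁ (branch-prefix k)) (proj₂ (branch-prefix k))
    where
    A : List ℕ
    A = applyUpTo branch k
    m : ℕ
    m = proj₁ (raySeq-suc k)
    extend : ∀ zs → raySeq k ≡ A ++ zs → ∃ λ zs′ → raySeq (suc k) ≡ applyUpTo branch (suc k) ++ zs′
    extend [] e = ⊥-elim (<⇒≢ (+-monoˡ-≤ k 1≤length-raySeq₀)
      (trans (sym (length-applyUpTo branch k)) (trans (cong length (sym (trans e (++-identityʳ A)))) (length-raySeq k))))
    extend (z ∷ zs) e = zs ++ [ m ] , (begin
        raySeq (suc k)                      ≡⟨ proj₂ (raySeq-suc k) ⟩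
        raySeq k ++ [ m ]                   ≡⟨ cong (_++ [ m ]) e ⟩
        (A ++ z ∷ zs) ++ [ m ]              ≡⟨ ++-assoc A (z ∷ zs) [ m ] ⟩
        A ++ z ∷ zs ++ [ m ]                ≡⟨ sym (++-assoc A [ z ] (zs ++ [ m ])) ⟩
        (A ++ [ z ]) ++ zs ++ [ m ]         ≡⟨ cong (λ w → (A ++ [ w ]) ++ zs ++ [ m ]) (sym branch-k≡z) ⟩
        (A ++ [ branch k ]) ++ zs ++ [ m ]  ≡⟨ cong (_++ zs ++ [ m ]) (applyUpTo-∷ʳ branch k) ⟩
        applyUpTo branch (suc k) ++ zs ++ [ m ] ∎)
      where
      open ≡-Reasoning
      branch-k≡z : branch k ≡ z
      branch-k≡z = trans (cong (λ l → lookupOr0 l k) e)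
                         (subst (λ n → lookupOr0 (A ++ z ∷ zs) n ≡ z) (length-applyUpTo branch k) (lookupOr0-++ A z zs))

  absurd : ⊥
  absurd = noPath (branch , λ k → Normal.prefixes (normal _ (ray∈R k)) (applyUpTo branch k)
                                    (proj₁ (branch-prefix k)) (proj₂ (branch-prefix k)))

opaque
  treeTileChecker : Term
  treeTileChecker = Cₑ (compile (toExpr tileᴮ)) (Pₑ Iₑ Zₑ)

  ev-treeTileChecker : ∀ o t → ev o treeTileChecker t ≡ b2n (tileB o t)
  ev-treeTileChecker o t = trans (compile-correct o [ t ] (toExpr tileᴮ)) (TileD.eval-tileᴮ o t)

  treeTileChecker≤1 : ∀ o n → ev o treeTileChecker n ≤ 1
  treeTileChecker≤1 o n = subst (_≤ 1) (sym (ev-treeTileChecker o n)) (b2n≤1 (tileB o n))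

module TreeTileSet (lem : ∀ {ℓ} → ExcludedMiddle ℓ) (o : ℕ → ℕ) where
  open TreeTiles o

  InTileSet : ℕ → Set
  InTileSet t = ev o treeTileChecker t ≡ 1

  InTileSet⇔tileB : ∀ t → InTileSet t ⇔ T (tileB o t)
  InTileSet⇔tileB t = subst (λ n → (n ≡ 1) ⇔ T (tileB o t)) (sym (ev-treeTileChecker o t)) (b2n≡1⇔T (tileB o t))

  wellFounded⇒onlyFinite : WellFoundedTree InTree → OnlyFiniteConnectedTilings InTileSet
  wellFounded⇒onlyFinite (tree , noPath) R F conn (F∈S , horizontal , vertical) with lem {P = Finite R}
  ... | yes finite = finite
  ... | no infinite = ⊥-elim (TreeTilingsFinite.absurd lem o tree noPath R F conn
                        ((λ q rq → to (InTileSet⇔tileB (F q)) (F∈S q rq)) , horizontal , vertical) infinite)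

  onlyFinite⇒wellFounded : OnlyFiniteConnectedTilings InTileSet → WellFoundedTree InTree
  onlyFinite⇒wellFounded finite = onlyFinite⇒tree lem finite′ , onlyFinite⇒noPath finite′
    where
    finite′ : OnlyFiniteConnectedTilings (λ t → T (tileB o t))
    finite′ = OnlyFiniteConnectedTilings-resp InTileSet⇔tileB finite

well≤snt : (∀ {ℓ} → ExcludedMiddle ℓ) → WELL ≤m SNT
well≤snt lem = UniformReduction.reduction lem encodeSeq encodeSeq-onto (λ n → n) id-onto
  WellFoundedTree OnlyFiniteConnectedTilings WellFoundedTree-resp OnlyFiniteConnectedTilings-resp
  treeTileChecker (λ o _ → treeTileChecker≤1 o)
  (λ o _ → mk⇔ (TreeTileSet.wellFounded⇒onlyFinite lem o) (TreeTileSet.onlyFinite⇒wellFounded lem o))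

mainTheorem3 : (∀ {ℓ} → ExcludedMiddle ℓ) → SNT ≡m WELL
mainTheorem3 lem = snt≤well lem , well≤snt lem
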